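{- Let $(\mathcal{C},\otimes,I)$ be a symmetric monoidal category. Then $\mathrm{Comb}_\infty$ (defined in the context) is a symmetric monoidal category whose objects are the families $X\in[\mathbb{N},\mathcal{C}]$, whose hom-sets are $\mathrm{Comb}_\infty(X,Y)$, whose sequential composition, monoidal product and inclusion are as described in the context, and whose monoidal product on objects is the pointwise product $(X\otimes X')_n=X_n\otimes X'_n$ with unit the constant family at $I$. Moreover the assignment $i\colon[\mathbb{N},\mathcal{C}]\to\mathrm{Comb}_\infty$ sending each family to itself and each family of morphisms $(h_n\colon X_n\to Y_n)_n$ to the comb with all memories $I$ and components $h_n$ (composed with unitors) is a strict monoidal, identity-on-objects functor.
   Context: Let $[\mathbb{N},\mathcal{C}]$ denote the category of $\mathbb{N}$-indexed families of objects of $\mathcal{C}$ (with families of morphisms as arrows), symmetric monoidal pointwise. For $X,Y\in[\mathbb{N},\mathcal{C}]$ and $n\in\mathbb{N}$ define the set (a coend in sets) $$\mathrm{Comb}_n^{+}(X,Y)=\int^{M_0,\dots,M_n\in\mathcal{C}}\prod_{i=0}^{n}\mathcal{C}(M_{i-1}\otimes X_i,\,M_i\otimes Y_i),\qquad M_{ -1}:=I.$$ Thus an element is a class $[f_0,\dots,f_n]$ of tuples with $f_i\colon M_{i-1}\otimes X_i\to M_i\otimes Y_i$, modulo the equivalence relation generated by $[\dots,(m_{i-1}\otimes\mathrm{id})\circ f_{i-1},(m_i\otimes \mathrm{id})\circ f_i,\dots]\sim[\dots,f_{i-1}\circ(m_{i-2}\otimes\mathrm{id}),f_i\circ(m_{i-1}\otimes\mathrm{id}),\dots]$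 for morphisms $m_i$ between the memory objects (the last memory $M_n$ is an open wire, also subject to this relation). Forgetting the last component gives well-defined projections $\mathrm{Comb}_{n+1}^+(X,Y)\to\mathrm{Comb}_n^+(X,Y)$, and $\mathrm{Comb}_\infty(X,Y):=\varprojlim_n\mathrm{Comb}_n^+(X,Y)$; its elements are written $[f_0,f_1,\dots]$. Sequential composition: for $f=[f_i]$ with $f_i\colon M_{i-1}\otimes X_i\to M_i\otimes Y_i$ and $g=[g_i]$ with $g_i\colon N_{i-1}\otimes Y_i\to N_i\otimes Z_i$, the composite $g\circ f\in\mathrm{Comb}_\infty(X,Z)$ has memories $M_i\otimes N_i$ and $i$-th component obtained by applying $f_i\otimes\mathrm{id}_{N_{i-1}}$ and then $\mathrm{id}_{M_i}\otimes g_i$, with symmetries/associators/unitors inserted to make types match. Parallel composition: for $f\colon X\to Y$ with memories $M_i$ and $f'\colon X'\to Y'$ with memories $M'_i$, $f\otimes f'\colon X\otimes X'\to Y\otimes Y'$ has memories $M_i\otimes M'_i$ and components $f_i\otimes f'_i$ conjugated by the appropriate symmetries. Identities, unitors, associators and symmetries of $\mathrm{Comb}_\infty$ are the images under $i$ of those of $[\mathbb{N},\mathcal{C}]$. -}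

module Defs where

open import Level using (Level; _⊔_) renaming (suc to lsuc)
open import Data.Nat using (ℕ; zero; suc)
open import Data.Product using (Σ; _×_; _,_)
open import Relation.Binary.Core using (Rel)
open import Relation.Binary.Structures using (IsEquivalence)
open import Relation.Binary.Construct.Closure.Equivalence using (EqClosure)
open import Relation.Binary.Construct.Closure.ReflexiveTransitive using (ε)
open import Relation.Binary.PropositionalEquality using (_≡_; refl; cong; subst; sym)

-- Hom-sets are setoids (the standard Agda rendering of "sets").

record SMCStructure {o ℓ e} (Obj : Set o) (Hom : Obj → Obj → Set ℓ)
       (_≈_ : ∀ {A B} → Rel (Hom A B) e)
       (_⊗₀_ : Obj → Obj → Obj) (𝟙 : Obj) : Set (o ⊔ ℓ ⊔ e) where
  infixr 9 _∘_
  infixr 10 _⊗₁_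
  field
    id   : ∀ {A} → Hom A A
    _∘_  : ∀ {A B C} → Hom B C → Hom A B → Hom A C
    _⊗₁_ : ∀ {A B C D} → Hom A B → Hom C D → Hom (A ⊗₀ C) (B ⊗₀ D)
    α    : ∀ {A B C} → Hom ((A ⊗₀ B) ⊗₀ C) (A ⊗₀ (B ⊗₀ C))
    α⁻¹  : ∀ {A B C} → Hom (A ⊗₀ (B ⊗₀ C)) ((A ⊗₀ B) ⊗₀ C)
    unitorˡ   : ∀ {A} → Hom (𝟙 ⊗₀ A) A
    unitorˡ⁻¹ : ∀ {A} → Hom A (𝟙 ⊗₀ A)
    unitorʳ   : ∀ {A} → Hom (A ⊗₀ 𝟙) A
    unitorʳ⁻¹ : ∀ {A} → Hom A (A ⊗₀ 𝟙)
    σ    : ∀ {A B} → Hom (A ⊗₀ B) (B ⊗₀ A)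
    ≈-equiv   : ∀ {A B} → IsEquivalence (_≈_ {A} {B})
    ∘-resp-≈  : ∀ {A B C} {f f' : Hom B C} {g g' : Hom A B} →
                f ≈ f' → g ≈ g' → (f ∘ g) ≈ (f' ∘ g')
    identityˡ : ∀ {A B} {f : Hom A B} → (id ∘ f) ≈ f
    identityʳ : ∀ {A B} {f : Hom A B} → (f ∘ id) ≈ f
    assoc     : ∀ {A B C D} {f : Hom A B} {g : Hom B C} {h : Hom C D} →
                ((h ∘ g) ∘ f) ≈ (h ∘ (g ∘ f))
    ⊗-resp-≈  : ∀ {A B C D} {f f' : Hom A B} {g g' : Hom C D} →
                f ≈ f' → g ≈ g' → (f ⊗₁ g) ≈ (f' ⊗₁ g')
    ⊗-identity : ∀ {A B} → (id {A} ⊗₁ id {B}) ≈ id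
    ⊗-homomorphism : ∀ {A B C D E F} {f : Hom A B} {g : Hom B C}
                       {h : Hom D E} {k : Hom E F} →
                     ((g ∘ f) ⊗₁ (k ∘ h)) ≈ ((g ⊗₁ k) ∘ (f ⊗₁ h))
    α-natural : ∀ {A B C A' B' C'} {f : Hom A A'} {g : Hom B B'} {h : Hom C C'} →
                (α ∘ ((f ⊗₁ g) ⊗₁ h)) ≈ ((f ⊗₁ (g ⊗₁ h)) ∘ α)
    α-isoˡ : ∀ {A B C} → (α⁻¹ ∘ α {A} {B} {C}) ≈ id
    α-isoʳ : ∀ {A B C} → (α ∘ α⁻¹ {A} {B} {C}) ≈ id
    unitorˡ-natural : ∀ {A B} {f : Hom A B} → (unitorˡ ∘ (id {𝟙} ⊗₁ f)) ≈ (f ∘ unitorˡ)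
    unitorˡ-isoˡ : ∀ {A} → (unitorˡ⁻¹ ∘ unitorˡ {A}) ≈ id
    unitorˡ-isoʳ : ∀ {A} → (unitorˡ ∘ unitorˡ⁻¹ {A}) ≈ id
    unitorʳ-natural : ∀ {A B} {f : Hom A B} → (unitorʳ ∘ (f ⊗₁ id {𝟙})) ≈ (f ∘ unitorʳ)
    unitorʳ-isoˡ : ∀ {A} → (unitorʳ⁻¹ ∘ unitorʳ {A}) ≈ id
    unitorʳ-isoʳ : ∀ {A} → (unitorʳ ∘ unitorʳ⁻¹ {A}) ≈ id
    σ-natural : ∀ {A B C D} {f : Hom A B} {g : Hom C D} →
                (σ ∘ (f ⊗₁ g)) ≈ ((g ⊗₁ f) ∘ σ)
    σ-involutive : ∀ {A B} → (σ {B} {A} ∘ σ {A} {B}) ≈ id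
    pentagon : ∀ {W X Y Z} →
      (α {W} {X} {Y ⊗₀ Z} ∘ α {W ⊗₀ X} {Y} {Z})
      ≈ ((id {W} ⊗₁ α {X} {Y} {Z}) ∘ (α {W} {X ⊗₀ Y} {Z} ∘ (α {W} {X} {Y} ⊗₁ id {Z})))
    triangle : ∀ {X Y} →
      ((id {X} ⊗₁ unitorˡ {Y}) ∘ α {X} {𝟙} {Y}) ≈ (unitorʳ {X} ⊗₁ id {Y})
    hexagon : ∀ {X Y Z} →
      (α {Y} {Z} {X} ∘ (σ {X} {Y ⊗₀ Z} ∘ α {X} {Y} {Z}))
      ≈ ((id {Y} ⊗₁ σ {X} {Z}) ∘ (α {Y} {X} {Z} ∘ (σ {X} {Y} ⊗₁ id {Z})))

record SMC o ℓ e : Set (lsuc (o ⊔ ℓ ⊔ e)) where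
  infix 4 _≈_
  infixr 11 _⊗₀_
  field
    Obj  : Set o
    Hom  : Obj → Obj → Set ℓ
    _≈_  : ∀ {A B} → Rel (Hom A B) e
    _⊗₀_ : Obj → Obj → Obj
    𝟙    : Obj
    structure : SMCStructure Obj Hom _≈_ _⊗₀_ 𝟙
  open SMCStructure structure public

module Combs {o ℓ e} (C : SMC o ℓ e) where
  open SMC C

  Fam : Set o
  Fam = ℕ → Obj

  FamHom : Fam → Fam → Set ℓ
  FamHom X Y = ∀ n → Hom (X n) (Y n)

  _⊗ᶠ_ : Fam → Fam → Fam
  (X ⊗ᶠ X') n = X n ⊗₀ X' n

  𝟙ᶠ : Fam
  𝟙ᶠ _ = 𝟙

  -- Tuple X Y P k n : tuples (f_k , … , f_{k+n}) with
  -- f_i : M_{i-1} ⊗ X_i → M_i ⊗ Y_i, where M_{k-1} := P, together with the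
  -- memories M_k , … , M_{k+n} (the last one is the open wire).
  Tuple : Fam → Fam → Obj → ℕ → ℕ → Set (o ⊔ ℓ)
  Tuple X Y P k zero    = Σ Obj λ M → Hom (P ⊗₀ X k) (M ⊗₀ Y k)
  Tuple X Y P k (suc n) = Σ Obj λ M → Hom (P ⊗₀ X k) (M ⊗₀ Y k) × Tuple X Y M (suc k) n

  -- Generating relation of the coend: (A , f) ~ (B , g) when there are
  -- m_i : A_i → B_i and h_i : B_{i-1} ⊗ X_i → A_i ⊗ Y_i with
  -- f_i = h_i ∘ (m_{i-1} ⊗ id) and g_i = (m_i ⊗ id) ∘ h_i, where the
  -- incoming morphism m_{k-1} is the given p (at top level: id on I).
  Step : ∀ {X Y P P'} k n → Hom P P' → Tuple X Y P k n → Tuple X Y P' k n → Set (ℓ ⊔ e)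
  Step {X} {Y} {P} {P'} k zero p (A , f) (B , g) =
    Σ (Hom A B) λ m → Σ (Hom (P' ⊗₀ X k) (A ⊗₀ Y k)) λ h →
      (f ≈ (h ∘ (p ⊗₁ id))) × (g ≈ ((m ⊗₁ id) ∘ h))
  Step {X} {Y} {P} {P'} k (suc n) p (A , f , t) (B , g , u) =
    Σ (Hom A B) λ m → Σ (Hom (P' ⊗₀ X k) (A ⊗₀ Y k)) λ h →
      (f ≈ (h ∘ (p ⊗₁ id))) × (g ≈ ((m ⊗₁ id) ∘ h)) × Step (suc k) n m t u

  -- Comb⁺_n(X,Y) : representatives Tuple X Y I 0 n, modulo the equivalence
  -- relation generated by Step.
  Rep : Fam → Fam → ℕ → Set (o ⊔ ℓ)
  Rep X Y n = Tuple X Y 𝟙 0 n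

  CombEq : ∀ {X Y} n → Rel (Rep X Y n) (o ⊔ ℓ ⊔ e)
  CombEq n = EqClosure (Step 0 n id)

  proj : ∀ {X Y P} k n → Tuple X Y P k (suc n) → Tuple X Y P k n
  proj k zero    (M , f , _) = M , f
  proj k (suc n) (M , f , t) = M , f , proj (suc k) n t

  -- Comb_∞(X,Y) = lim_n Comb⁺_n(X,Y)
  record Comb∞ (X Y : Fam) : Set (o ⊔ ℓ ⊔ e) where
    field
      stage  : (n : ℕ) → Rep X Y n
      compat : ∀ n → CombEq n (proj 0 n (stage (suc n))) (stage n)
  open Comb∞ public

  infix 4 _≈∞_
  _≈∞_ : ∀ {X Y} → Rel (Comb∞ X Y) (o ⊔ ℓ ⊔ e)
  f ≈∞ g = ∀ n → CombEq n (stage f n) (stage g n)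

  seqComp : ∀ {P Q M N X Y Z} → Hom (P ⊗₀ X) (M ⊗₀ Y) → Hom (Q ⊗₀ Y) (N ⊗₀ Z) →
            Hom ((P ⊗₀ Q) ⊗₀ X) ((M ⊗₀ N) ⊗₀ Z)
  seqComp {P} {Q} {M} {N} {X} {Y} {Z} f g =
    α⁻¹ {M} {N} {Z} ∘ (id {M} ⊗₁ g) ∘ (id {M} ⊗₁ σ {Y} {Q}) ∘ α {M} {Y} {Q}
    ∘ (f ⊗₁ id {Q}) ∘ α⁻¹ {P} {X} {Q} ∘ (id {P} ⊗₁ σ {Q} {X}) ∘ α {P} {Q} {X}

  seqT : ∀ {X Y Z R P Q} k n → Hom R (P ⊗₀ Q) →
         Tuple X Y P k n → Tuple Y Z Q k n → Tuple X Z R k n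
  seqT k zero    p (M , f)     (N , g)     = (M ⊗₀ N) , (seqComp f g ∘ (p ⊗₁ id))
  seqT k (suc n) p (M , f , t) (N , g , u) =
    (M ⊗₀ N) , (seqComp f g ∘ (p ⊗₁ id)) , seqT (suc k) n id t u

  -- stage n of the sequential composite g ∘ f (memories M_i ⊗ N_i; the
  -- initial I is split as I ⊗ I by the inverse left unitor)
  seqStage : ∀ {X Y Z} → Comb∞ Y Z → Comb∞ X Y → (n : ℕ) → Rep X Z n
  seqStage g f n = seqT 0 n unitorˡ⁻¹ (stage f n) (stage g n)

  ι : ∀ {A B C D} → Hom ((A ⊗₀ B) ⊗₀ (C ⊗₀ D)) ((A ⊗₀ C) ⊗₀ (B ⊗₀ D))
  ι {A} {B} {C} {D} =
    α⁻¹ {A} {C} {B ⊗₀ D}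
    ∘ (id {A} ⊗₁ (α {C} {B} {D} ∘ (σ {B} {C} ⊗₁ id {D}) ∘ α⁻¹ {B} {C} {D}))
    ∘ α {A} {B} {C ⊗₀ D}

  parT : ∀ {X Y X' Y' R P P'} k n → Hom R (P ⊗₀ P') →
         Tuple X Y P k n → Tuple X' Y' P' k n → Tuple (X ⊗ᶠ X') (Y ⊗ᶠ Y') R k n
  parT k zero    p (M , f)     (M' , f')      = (M ⊗₀ M') , (ι ∘ (f ⊗₁ f') ∘ ι ∘ (p ⊗₁ id))
  parT k (suc n) p (M , f , t) (M' , f' , t') =
    (M ⊗₀ M') , (ι ∘ (f ⊗₁ f') ∘ ι ∘ (p ⊗₁ id)) , parT (suc k) n id t t'

  parStage : ∀ {X Y X' Y'} → Comb∞ X Y → Comb∞ X' Y' → (n : ℕ) → Rep (X ⊗ᶠ X') (Y ⊗ᶠ Y') n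
  parStage f f' n = parT 0 n unitorˡ⁻¹ (stage f n) (stage f' n)

  iT : ∀ {X Y} k n → FamHom X Y → Tuple X Y 𝟙 k n
  iT k zero    h = 𝟙 , (unitorˡ⁻¹ ∘ h k ∘ unitorˡ)
  iT k (suc n) h = 𝟙 , (unitorˡ⁻¹ ∘ h k ∘ unitorˡ) , iT (suc k) n h

  proj-iT : ∀ {X Y} k n (h : FamHom X Y) → proj k n (iT k (suc n) h) ≡ iT k n h
  proj-iT k zero    h = refl
  proj-iT k (suc n) h = cong (λ t → 𝟙 , (unitorˡ⁻¹ ∘ h k ∘ unitorˡ) , t) (proj-iT (suc k) n h)

  i : ∀ {X Y} → FamHom X Y → Comb∞ X Y
  stage  (i h) n = iT 0 n h
  compat (i {X} {Y} h) n =
    subst (λ t → CombEq n t (iT 0 n h)) (sym (proj-iT 0 n h)) ε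

  CombStructure : Set (o ⊔ ℓ ⊔ e)
  CombStructure = SMCStructure Fam Comb∞ _≈∞_ _⊗ᶠ_ 𝟙ᶠ

  record IsComb∞SMC (D : CombStructure) : Set (o ⊔ ℓ ⊔ e) where
    module D = SMCStructure D
    field
      comp-is-seq : ∀ {X Y Z} (g : Comb∞ Y Z) (f : Comb∞ X Y) n →
                    CombEq n (stage (g D.∘ f) n) (seqStage g f n)
      tensor-is-par : ∀ {X Y X' Y'} (f : Comb∞ X Y) (f' : Comb∞ X' Y') n →
                      CombEq n (stage (f D.⊗₁ f') n) (parStage f f' n)
      id-is-i    : ∀ {X} → D.id {X} ≈∞ i (λ n → id)
      α-is-i     : ∀ {X Y Z} → D.α {X} {Y} {Z} ≈∞ i (λ n → α)
      α⁻¹-is-i   : ∀ {X Y Z} → D.α⁻¹ {X} {Y} {Z} ≈∞ i (λ n → α⁻¹)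
      unitorˡ-is-i   : ∀ {X} → D.unitorˡ {X} ≈∞ i (λ n → unitorˡ)
      unitorˡ⁻¹-is-i : ∀ {X} → D.unitorˡ⁻¹ {X} ≈∞ i (λ n → unitorˡ⁻¹)
      unitorʳ-is-i   : ∀ {X} → D.unitorʳ {X} ≈∞ i (λ n → unitorʳ)
      unitorʳ⁻¹-is-i : ∀ {X} → D.unitorʳ⁻¹ {X} ≈∞ i (λ n → unitorʳ⁻¹)
      σ-is-i     : ∀ {X Y} → D.σ {X} {Y} ≈∞ i (λ n → σ)
      -- i is a functor (identity on objects; preserves identities by id-is-i)
      i-resp-≈   : ∀ {X Y} {h h' : FamHom X Y} → (∀ n → h n ≈ h' n) → i h ≈∞ i h'
      i-∘        : ∀ {X Y Z} (h : FamHom Y Z) (k : FamHom X Y) →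
                   i (λ n → h n ∘ k n) ≈∞ (i h D.∘ i k)
      -- i is strict monoidal (on objects this holds definitionally, since
      -- the tensor and unit of D are the pointwise ones; the structure
      -- isomorphisms are preserved by the *-is-i fields)
      i-⊗        : ∀ {X Y X' Y'} (h : FamHom X Y) (h' : FamHom X' Y') →
                   i (λ n → h n ⊗₁ h' n) ≈∞ (i h D.⊗₁ i h')

module Submission where

-- Composition (∘ᶜ) and tensor (⊗ᶜ) of combs are defined stagewise
-- on representatives (seqT, parT of Defs).  Every law of an SMC then reduces
-- to a statement about representatives: the two sides of the law are tuples
-- whose components agree up to conjugation by invertible memory morphisms
-- (`Conjugate`), and a conjugation is a single generating step of the coend
-- relation.  Each component identity is an equation between two composites
-- of structure morphisms of C and a few arbitrary "boxes"; such equations are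
-- discharged by a coherence theorem for symmetric monoidal categories,
-- proved here by strictification: words are interpreted as right-nested
-- lists of objects, every formal term becomes a composite of boxes and
-- elementary wire-crossings (`chainOf`), and two terms are equal as soon as
-- their chains are (`coherence-chain`).  Well-definedness of ∘ᶜ and ⊗ᶜ on
-- the coend follows because both operations map generating steps to
-- generating steps (memory morphisms slide through composites).  The laws
-- that only involve images of i (isomorphism laws, pentagon, triangle,
-- hexagon) are transported from C along i, since i preserves ∘ and ⊗.

open import Data.Nat using (ℕ; zero; suc)
open import Level using (_⊔_)
open import Data.Product using (Σ; _×_; _,_)
open import Relation.Binary.Structures using (IsEquivalence)
open import Relation.Binary.PropositionalEquality as PE using (_≡_)
import Relation.Binary.Construct.Closure.Equivalence as EqC
open import Relation.Binary.Construct.Closure.ReflexiveTransitive using (ε)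
open import Defs

module SMCReasoning {o ℓ e} (𝒞 : SMC o ℓ e) where
  open SMC 𝒞 public

  infix  1 begin_
  infixr 2 _≈⟨_⟩_ _≈˘⟨_⟩_
  infix  3 _∎

  refl≈ : ∀ {A B} {f : Hom A B} → f ≈ f
  refl≈ = IsEquivalence.refl ≈-equiv
  sym≈ : ∀ {A B} {f g : Hom A B} → f ≈ g → g ≈ f
  sym≈ = IsEquivalence.sym ≈-equiv
  trans≈ : ∀ {A B} {f g h : Hom A B} → f ≈ g → g ≈ h → f ≈ h
  trans≈ = IsEquivalence.trans ≈-equiv

  -- Reasoning combinators uniform in the hom-setoid (the library's setoid
  -- reasoning would need one instantiation per pair of objects).
  begin_ : ∀ {A B} {f g : Hom A B} → f ≈ g → f ≈ g
  begin p = p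
  _≈⟨_⟩_ : ∀ {A B} (f : Hom A B) {g h : Hom A B} → f ≈ g → g ≈ h → f ≈ h
  f ≈⟨ p ⟩ q = trans≈ p q
  _≈˘⟨_⟩_ : ∀ {A B} (f : Hom A B) {g h : Hom A B} → g ≈ f → g ≈ h → f ≈ h
  f ≈˘⟨ p ⟩ q = trans≈ (sym≈ p) q
  _∎ : ∀ {A B} (f : Hom A B) → f ≈ f
  f ∎ = refl≈

  ∘ˡ : ∀ {A B D} {f f' : Hom B D} {g : Hom A B} → f ≈ f' → (f ∘ g) ≈ (f' ∘ g)
  ∘ˡ p = ∘-resp-≈ p refl≈
  ∘ʳ : ∀ {A B D} {f : Hom B D} {g g' : Hom A B} → g ≈ g' → (f ∘ g) ≈ (f ∘ g')
  ∘ʳ p = ∘-resp-≈ refl≈ p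
  ⊗ˡ : ∀ {A B D E} {f f' : Hom A B} {g : Hom D E} → f ≈ f' → (f ⊗₁ g) ≈ (f' ⊗₁ g)
  ⊗ˡ p = ⊗-resp-≈ p refl≈
  ⊗ʳ : ∀ {A B D E} {f : Hom A B} {g g' : Hom D E} → g ≈ g' → (f ⊗₁ g) ≈ (f ⊗₁ g')
  ⊗ʳ p = ⊗-resp-≈ refl≈ p

  sym-assoc : ∀ {A B D E} {f : Hom A B} {g : Hom B D} {h : Hom D E} →
              (h ∘ (g ∘ f)) ≈ ((h ∘ g) ∘ f)
  sym-assoc = sym≈ assoc

  cancelInv : ∀ {A B D} {f : Hom A B} {g : Hom B A} {h : Hom D A} →
              (g ∘ f) ≈ id → (g ∘ (f ∘ h)) ≈ h
  cancelInv p = trans≈ sym-assoc (trans≈ (∘ˡ p) identityˡ)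

  pullˡ : ∀ {A B D E} {x : Hom D E} {y : Hom B D} {z : Hom B E} {r : Hom A B} →
          (x ∘ y) ≈ z → (x ∘ (y ∘ r)) ≈ (z ∘ r)
  pullˡ p = trans≈ sym-assoc (∘ˡ p)
  extendʳ : ∀ {A B D E D'} {x : Hom D E} {y : Hom B D} {z : Hom D' E} {w : Hom B D'} {r : Hom A B} →
            (x ∘ y) ≈ (z ∘ w) → (x ∘ (y ∘ r)) ≈ (z ∘ (w ∘ r))
  extendʳ p = trans≈ sym-assoc (trans≈ (∘ˡ p) assoc)

  id⊗∘ : ∀ {A B D E} {f : Hom A B} {g : Hom B D} →
         (id {E} ⊗₁ (g ∘ f)) ≈ ((id ⊗₁ g) ∘ (id ⊗₁ f))
  id⊗∘ = trans≈ (⊗ˡ (sym≈ identityˡ)) ⊗-homomorphism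
  ∘⊗id : ∀ {A B D E} {f : Hom A B} {g : Hom B D} →
         ((g ∘ f) ⊗₁ id {E}) ≈ ((g ⊗₁ id) ∘ (f ⊗₁ id))
  ∘⊗id = trans≈ (⊗ʳ (sym≈ identityˡ)) ⊗-homomorphism
  id⊗id : ∀ {A B} → id {A ⊗₀ B} ≈ (id ⊗₁ id)
  id⊗id = sym≈ ⊗-identity

  slide : ∀ {A B D E} {f : Hom A B} {g : Hom D E} →
          ((f ⊗₁ id) ∘ (id ⊗₁ g)) ≈ ((id ⊗₁ g) ∘ (f ⊗₁ id))
  slide = trans≈ (sym≈ split₁) split₂
    where
    split₁ : ∀ {A B D E} {f : Hom A B} {g : Hom D E} → (f ⊗₁ g) ≈ ((f ⊗₁ id) ∘ (id ⊗₁ g))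
    split₁ = trans≈ (⊗-resp-≈ (sym≈ identityʳ) (sym≈ identityˡ)) ⊗-homomorphism
    split₂ : ∀ {A B D E} {f : Hom A B} {g : Hom D E} → (f ⊗₁ g) ≈ ((id ⊗₁ g) ∘ (f ⊗₁ id))
    split₂ = trans≈ (⊗-resp-≈ (sym≈ identityˡ) (sym≈ identityʳ)) ⊗-homomorphism

  ⊗id-inverse : ∀ {A B D} {f : Hom A B} {g : Hom B A} → (f ∘ g) ≈ id → ((f ⊗₁ id {D}) ∘ (g ⊗₁ id)) ≈ id
  ⊗id-inverse p = trans≈ (sym≈ ∘⊗id) (trans≈ (⊗ˡ p) ⊗-identity)
  id⊗-inverse : ∀ {A B D} {f : Hom A B} {g : Hom B A} → (f ∘ g) ≈ id → ((id {D} ⊗₁ f) ∘ (id ⊗₁ g)) ≈ id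
  id⊗-inverse p = trans≈ (sym≈ id⊗∘) (trans≈ (⊗ʳ p) ⊗-identity)

  inverse-square : ∀ {A B A' B'} {i : Hom A A'} {j : Hom A' A} {i' : Hom B B'} {j' : Hom B' B}
                   {f : Hom A B} {g : Hom A' B'} →
                   (j' ∘ i') ≈ id → (i ∘ j) ≈ id → (i' ∘ f) ≈ (g ∘ i) → (f ∘ j) ≈ (j' ∘ g)
  inverse-square {i = i} {j} {i'} {j'} {f} {g} p q n = begin
    f ∘ j                  ≈˘⟨ identityˡ ⟩
    id ∘ (f ∘ j)           ≈˘⟨ ∘ˡ p ⟩
    (j' ∘ i') ∘ (f ∘ j)    ≈⟨ assoc ⟩
    j' ∘ (i' ∘ (f ∘ j))    ≈⟨ ∘ʳ sym-assoc ⟩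
    j' ∘ ((i' ∘ f) ∘ j)    ≈⟨ ∘ʳ (∘ˡ n) ⟩
    j' ∘ ((g ∘ i) ∘ j)     ≈⟨ ∘ʳ assoc ⟩
    j' ∘ (g ∘ (i ∘ j))     ≈⟨ ∘ʳ (∘ʳ q) ⟩
    j' ∘ (g ∘ id)          ≈⟨ ∘ʳ identityʳ ⟩
    j' ∘ g ∎

  iso-epic : ∀ {A B D} {i : Hom A B} {j : Hom B A} {f g : Hom B D} →
             (i ∘ j) ≈ id → (f ∘ i) ≈ (g ∘ i) → f ≈ g
  iso-epic {i = i} {j} {f} {g} q p = begin
    f                ≈˘⟨ identityʳ ⟩
    f ∘ id           ≈˘⟨ ∘ʳ q ⟩
    f ∘ (i ∘ j)      ≈⟨ sym-assoc ⟩
    (f ∘ i) ∘ j      ≈⟨ ∘ˡ p ⟩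
    (g ∘ i) ∘ j      ≈⟨ assoc ⟩
    g ∘ (i ∘ j)      ≈⟨ ∘ʳ q ⟩
    g ∘ id           ≈⟨ identityʳ ⟩
    g ∎
  iso-monic : ∀ {A B D} {i : Hom B D} {j : Hom D B} {f g : Hom A B} →
              (j ∘ i) ≈ id → (i ∘ f) ≈ (i ∘ g) → f ≈ g
  iso-monic {i = i} {j} {f} {g} q p = begin
    f                ≈˘⟨ identityˡ ⟩
    id ∘ f           ≈˘⟨ ∘ˡ q ⟩
    (j ∘ i) ∘ f      ≈⟨ assoc ⟩
    j ∘ (i ∘ f)      ≈⟨ ∘ʳ p ⟩
    j ∘ (i ∘ g)      ≈⟨ sym-assoc ⟩
    (j ∘ i) ∘ g      ≈⟨ ∘ˡ q ⟩
    id ∘ g           ≈⟨ identityˡ ⟩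
    g ∎

  -- The functors 𝟙 ⊗ - and - ⊗ 𝟙 are faithful, being isomorphic to the
  -- identity via the unitors.
  𝟙⊗-faithful : ∀ {A B} {f g : Hom A B} → (id {𝟙} ⊗₁ f) ≈ (id ⊗₁ g) → f ≈ g
  𝟙⊗-faithful p = iso-epic unitorˡ-isoʳ
    (trans≈ (sym≈ unitorˡ-natural) (trans≈ (∘ʳ p) unitorˡ-natural))
  ⊗𝟙-faithful : ∀ {A B} {f g : Hom A B} → (f ⊗₁ id {𝟙}) ≈ (g ⊗₁ id) → f ≈ g
  ⊗𝟙-faithful p = iso-epic unitorʳ-isoʳ
    (trans≈ (sym≈ unitorʳ-natural) (trans≈ (∘ʳ p) unitorʳ-natural))

  -- Kelly's identity λ_{A⊗B} ∘ α = λ_A ⊗ id, from the pentagon and the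
  -- triangle (after tensoring with 𝟙 on the left).
  unitorˡ-α : ∀ {A B} → (unitorˡ {A ⊗₀ B} ∘ α {𝟙} {A} {B}) ≈ (unitorˡ ⊗₁ id)
  unitorˡ-α {A} {B} = 𝟙⊗-faithful (iso-epic {i = α ∘ (α ⊗₁ id)} {j = (α⁻¹ ⊗₁ id) ∘ α⁻¹} αα-inverse step)
    where
    αα-inverse : ((α {𝟙} {𝟙 ⊗₀ A} {B} ∘ (α {𝟙} {𝟙} {A} ⊗₁ id)) ∘ ((α⁻¹ ⊗₁ id) ∘ α⁻¹)) ≈ id
    αα-inverse = trans≈ assoc (trans≈ (∘ʳ (pullˡ (⊗id-inverse α-isoʳ))) (trans≈ (∘ʳ identityˡ) α-isoʳ))
    step : ((id {𝟙} ⊗₁ (unitorˡ ∘ α)) ∘ (α ∘ (α ⊗₁ id))) ≈ ((id ⊗₁ (unitorˡ ⊗₁ id)) ∘ (α ∘ (α ⊗₁ id)))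
    step = begin
      (id ⊗₁ (unitorˡ ∘ α)) ∘ (α ∘ (α ⊗₁ id))         ≈⟨ ∘ˡ id⊗∘ ⟩
      ((id ⊗₁ unitorˡ) ∘ (id ⊗₁ α)) ∘ (α ∘ (α ⊗₁ id)) ≈⟨ assoc ⟩
      (id ⊗₁ unitorˡ) ∘ ((id ⊗₁ α) ∘ (α ∘ (α ⊗₁ id))) ≈˘⟨ ∘ʳ pentagon ⟩
      (id ⊗₁ unitorˡ) ∘ (α ∘ α)                       ≈⟨ sym-assoc ⟩
      ((id ⊗₁ unitorˡ) ∘ α) ∘ α                       ≈⟨ ∘ˡ triangle ⟩
      (unitorʳ ⊗₁ id) ∘ α                             ≈⟨ ∘ˡ (⊗ʳ id⊗id) ⟩
      (unitorʳ ⊗₁ (id ⊗₁ id)) ∘ α                     ≈˘⟨ α-natural ⟩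
      α ∘ ((unitorʳ ⊗₁ id) ⊗₁ id)                     ≈˘⟨ ∘ʳ (⊗ˡ triangle) ⟩
      α ∘ (((id ⊗₁ unitorˡ) ∘ α) ⊗₁ id)               ≈⟨ ∘ʳ ∘⊗id ⟩
      α ∘ (((id ⊗₁ unitorˡ) ⊗₁ id) ∘ (α ⊗₁ id))       ≈⟨ sym-assoc ⟩
      (α ∘ ((id ⊗₁ unitorˡ) ⊗₁ id)) ∘ (α ⊗₁ id)       ≈⟨ ∘ˡ α-natural ⟩
      ((id ⊗₁ (unitorˡ ⊗₁ id)) ∘ α) ∘ (α ⊗₁ id)       ≈⟨ assoc ⟩
      (id ⊗₁ (unitorˡ ⊗₁ id)) ∘ (α ∘ (α ⊗₁ id)) ∎

  -- λ ∘ σ = ρ, from the triangle, the hexagon and Kelly's identity.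
  unitorˡ-σ : ∀ {A} → (unitorˡ ∘ σ {A} {𝟙}) ≈ unitorʳ
  unitorˡ-σ {A} = sym≈ (⊗𝟙-faithful (iso-monic {i = σ {A} {𝟙}} {j = σ} σ-involutive chain))
    where
    chain : (σ ∘ (unitorʳ ⊗₁ id)) ≈ (σ ∘ ((unitorˡ ∘ σ) ⊗₁ id))
    chain = begin
      σ ∘ (unitorʳ ⊗₁ id)                      ≈˘⟨ ∘ʳ triangle ⟩
      σ ∘ ((id ⊗₁ unitorˡ) ∘ α)                ≈⟨ sym-assoc ⟩
      (σ ∘ (id ⊗₁ unitorˡ)) ∘ α                ≈⟨ ∘ˡ σ-natural ⟩
      ((unitorˡ ⊗₁ id) ∘ σ) ∘ α                ≈⟨ assoc ⟩
      (unitorˡ ⊗₁ id) ∘ (σ ∘ α)                ≈˘⟨ ∘ˡ unitorˡ-α ⟩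
      (unitorˡ ∘ α) ∘ (σ ∘ α)                  ≈⟨ assoc ⟩
      unitorˡ ∘ (α ∘ (σ ∘ α))                  ≈⟨ ∘ʳ hexagon ⟩
      unitorˡ ∘ ((id ⊗₁ σ) ∘ (α ∘ (σ ⊗₁ id)))  ≈⟨ pullˡ unitorˡ-natural ⟩
      (σ ∘ unitorˡ) ∘ (α ∘ (σ ⊗₁ id))          ≈⟨ assoc ⟩
      σ ∘ (unitorˡ ∘ (α ∘ (σ ⊗₁ id)))          ≈⟨ ∘ʳ (pullˡ unitorˡ-α) ⟩
      σ ∘ ((unitorˡ ⊗₁ id) ∘ (σ ⊗₁ id))        ≈˘⟨ ∘ʳ ∘⊗id ⟩
      σ ∘ ((unitorˡ ∘ σ) ⊗₁ id) ∎

  σ-unitʳ : ∀ {A} → σ {A} {𝟙} ≈ (unitorˡ⁻¹ ∘ unitorʳ)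
  σ-unitʳ = trans≈ (sym≈ identityˡ) (trans≈ (∘ˡ (sym≈ unitorˡ-isoˡ)) (trans≈ assoc (∘ʳ unitorˡ-σ)))

  σ-unitˡ : ∀ {A} → σ {𝟙} {A} ≈ (unitorʳ⁻¹ ∘ unitorˡ)
  σ-unitˡ = begin
    σ                                   ≈˘⟨ identityʳ ⟩
    σ ∘ id                              ≈˘⟨ ∘ʳ σ-inverse ⟩
    σ ∘ (σ ∘ (unitorʳ⁻¹ ∘ unitorˡ))     ≈⟨ cancelInv σ-involutive ⟩
    unitorʳ⁻¹ ∘ unitorˡ ∎
    where
    σ-inverse : (σ ∘ (unitorʳ⁻¹ ∘ unitorˡ)) ≈ id
    σ-inverse = trans≈ (∘ˡ σ-unitʳ) (trans≈ assoc (trans≈ (∘ʳ (cancelInv unitorʳ-isoʳ)) unitorˡ-isoˡ))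

  -- The hexagon solved for σ_{X,Y⊗Z}, and the dual formula for σ_{A⊗B,D}
  -- (obtained by inverting the first one).
  hexagon-σ : ∀ {X Y Z} → (α {Y} {Z} {X} ∘ σ {X} {Y ⊗₀ Z}) ≈
              ((id ⊗₁ σ) ∘ (α ∘ ((σ ⊗₁ id) ∘ α⁻¹)))
  hexagon-σ = begin
    α ∘ σ                                ≈˘⟨ identityʳ ⟩
    (α ∘ σ) ∘ id                         ≈˘⟨ ∘ʳ α-isoʳ ⟩
    (α ∘ σ) ∘ (α ∘ α⁻¹)                  ≈⟨ assoc ⟩
    α ∘ (σ ∘ (α ∘ α⁻¹))                  ≈⟨ ∘ʳ sym-assoc ⟩
    α ∘ ((σ ∘ α) ∘ α⁻¹)                  ≈⟨ sym-assoc ⟩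
    (α ∘ (σ ∘ α)) ∘ α⁻¹                  ≈⟨ ∘ˡ hexagon ⟩
    ((id ⊗₁ σ) ∘ (α ∘ (σ ⊗₁ id))) ∘ α⁻¹  ≈⟨ trans≈ assoc (∘ʳ assoc) ⟩
    (id ⊗₁ σ) ∘ (α ∘ ((σ ⊗₁ id) ∘ α⁻¹)) ∎

  σ-⊗ʳ : ∀ {X Y Z} → σ {X} {Y ⊗₀ Z} ≈ (α⁻¹ ∘ ((id ⊗₁ σ) ∘ (α ∘ ((σ ⊗₁ id) ∘ α⁻¹))))
  σ-⊗ʳ = trans≈ (sym≈ (cancelInv α-isoˡ)) (∘ʳ hexagon-σ)

  σ-⊗ˡ : ∀ {A B D} → σ {A ⊗₀ B} {D} ≈ (α ∘ ((σ ⊗₁ id) ∘ (α⁻¹ ∘ ((id ⊗₁ σ) ∘ α))))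
  σ-⊗ˡ {A} {B} {D} = begin
    σ                    ≈˘⟨ identityˡ ⟩
    id ∘ σ               ≈˘⟨ ∘ˡ Kσ ⟩
    (K ∘ σ) ∘ σ          ≈⟨ assoc ⟩
    K ∘ (σ ∘ σ)          ≈⟨ ∘ʳ σ-involutive ⟩
    K ∘ id               ≈⟨ identityʳ ⟩
    K ∎
    where
    K : Hom ((A ⊗₀ B) ⊗₀ D) (D ⊗₀ (A ⊗₀ B))
    K = α ∘ ((σ ⊗₁ id) ∘ (α⁻¹ ∘ ((id ⊗₁ σ) ∘ α)))
    Kσ : (K ∘ σ) ≈ id
    Kσ = begin
      K ∘ σ ≈⟨ trans≈ assoc (∘ʳ (trans≈ assoc (∘ʳ (trans≈ assoc (∘ʳ assoc))))) ⟩
      α ∘ ((σ ⊗₁ id) ∘ (α⁻¹ ∘ ((id ⊗₁ σ) ∘ (α ∘ σ))))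
        ≈⟨ ∘ʳ (∘ʳ (∘ʳ (∘ʳ hexagon-σ))) ⟩
      α ∘ ((σ ⊗₁ id) ∘ (α⁻¹ ∘ ((id ⊗₁ σ) ∘ ((id ⊗₁ σ) ∘ (α ∘ ((σ ⊗₁ id) ∘ α⁻¹))))))
        ≈⟨ ∘ʳ (∘ʳ (∘ʳ (pullˡ (id⊗-inverse σ-involutive)))) ⟩
      α ∘ ((σ ⊗₁ id) ∘ (α⁻¹ ∘ (id ∘ (α ∘ ((σ ⊗₁ id) ∘ α⁻¹)))))
        ≈⟨ ∘ʳ (∘ʳ (∘ʳ identityˡ)) ⟩
      α ∘ ((σ ⊗₁ id) ∘ (α⁻¹ ∘ (α ∘ ((σ ⊗₁ id) ∘ α⁻¹))))
        ≈⟨ ∘ʳ (∘ʳ (cancelInv α-isoˡ)) ⟩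
      α ∘ ((σ ⊗₁ id) ∘ ((σ ⊗₁ id) ∘ α⁻¹)) ≈⟨ ∘ʳ (pullˡ (⊗id-inverse σ-involutive)) ⟩
      α ∘ (id ∘ α⁻¹)                       ≈⟨ ∘ʳ identityˡ ⟩
      α ∘ α⁻¹                              ≈⟨ α-isoʳ ⟩
      id ∎

-- A coherence theorem for symmetric monoidal categories, by strictification.
-- A word is a formal tensor expression in objects and 𝟙; `push w T` lists
-- the atoms of w, right-nested, in front of a tail T, and `flatten` is the
-- canonical isomorphism ⟦ w ⟧ ⊗ T ≅ push w T.  Formal terms (structure
-- morphisms and arbitrary generators, closed under ∘ and ⊗) have a strict
-- interpretation `strict` in which α, λ, ρ are identities and σ is a
-- composite of elementary swaps `sw`; by `coherence`, two terms with equal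
-- strict interpretations are equal.  The strict interpretation is then
-- flattened into a list of generators and swaps (`chainOf`), and the rest
-- of the module provides the local moves (naturality of swaps, cancellation,
-- Yang-Baxter) used to identify such lists.
module Coherence {o ℓ e} (𝒞 : SMC o ℓ e) where
  open SMCReasoning 𝒞

  infixr 11 _⊗w_
  data Word : Set o where
    atom  : Obj → Word
    unit  : Word
    _⊗w_ : Word → Word → Word

  ⟦_⟧w : Word → Obj
  ⟦ atom a ⟧w = a
  ⟦ unit ⟧w = 𝟙
  ⟦ u ⊗w v ⟧w = ⟦ u ⟧w ⊗₀ ⟦ v ⟧w

  push : Word → Obj → Obj
  push (atom a) T = a ⊗₀ T
  push unit T = T
  push (u ⊗w v) T = push u (push v T)

  push₁ : (w : Word) {T T' : Obj} → Hom T T' → Hom (push w T) (push w T')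
  push₁ (atom a) g = id {a} ⊗₁ g
  push₁ unit g = g
  push₁ (u ⊗w v) g = push₁ u (push₁ v g)

  push₁-resp : ∀ w {T T'} {g g' : Hom T T'} → g ≈ g' → push₁ w g ≈ push₁ w g'
  push₁-resp (atom a) p = ⊗ʳ p
  push₁-resp unit p = p
  push₁-resp (u ⊗w v) p = push₁-resp u (push₁-resp v p)

  push₁-id : ∀ w {T} → push₁ w (id {T}) ≈ id
  push₁-id (atom a) = ⊗-identity
  push₁-id unit = refl≈
  push₁-id (u ⊗w v) = trans≈ (push₁-resp u (push₁-id v)) (push₁-id u)

  push₁-∘ : ∀ w {T T' T''} {g : Hom T' T''} {h : Hom T T'} → push₁ w (g ∘ h) ≈ (push₁ w g ∘ push₁ w h)
  push₁-∘ (atom a) = id⊗∘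
  push₁-∘ unit = refl≈
  push₁-∘ (u ⊗w v) = trans≈ (push₁-resp u (push₁-∘ v)) (push₁-∘ u)

  flatten : (w : Word) (T : Obj) → Hom (⟦ w ⟧w ⊗₀ T) (push w T)
  flatten (atom a) T = id
  flatten unit T = unitorˡ
  flatten (u ⊗w v) T = flatten u (push v T) ∘ ((id ⊗₁ flatten v T) ∘ α)

  unflatten : (w : Word) (T : Obj) → Hom (push w T) (⟦ w ⟧w ⊗₀ T)
  unflatten (atom a) T = id
  unflatten unit T = unitorˡ⁻¹
  unflatten (u ⊗w v) T = α⁻¹ ∘ ((id ⊗₁ unflatten v T) ∘ unflatten u (push v T))

  flatten-unflatten : ∀ w T → (flatten w T ∘ unflatten w T) ≈ id
  flatten-unflatten (atom a) T = identityˡ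
  flatten-unflatten unit T = unitorˡ-isoʳ
  flatten-unflatten (u ⊗w v) T = begin
    (flatten u _ ∘ ((id ⊗₁ flatten v T) ∘ α)) ∘ (α⁻¹ ∘ ((id ⊗₁ unflatten v T) ∘ unflatten u _))
      ≈⟨ trans≈ assoc (∘ʳ (trans≈ assoc (∘ʳ (cancelInv α-isoʳ)))) ⟩
    flatten u _ ∘ ((id ⊗₁ flatten v T) ∘ ((id ⊗₁ unflatten v T) ∘ unflatten u _))
      ≈⟨ ∘ʳ (pullˡ (id⊗-inverse (flatten-unflatten v T))) ⟩
    flatten u _ ∘ (id ∘ unflatten u _) ≈⟨ ∘ʳ identityˡ ⟩
    flatten u _ ∘ unflatten u _ ≈⟨ flatten-unflatten u _ ⟩
    id ∎

  unflatten-flatten : ∀ w T → (unflatten w T ∘ flatten w T) ≈ id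
  unflatten-flatten (atom a) T = identityˡ
  unflatten-flatten unit T = unitorˡ-isoˡ
  unflatten-flatten (u ⊗w v) T = begin
    (α⁻¹ ∘ ((id ⊗₁ unflatten v T) ∘ unflatten u _)) ∘ (flatten u _ ∘ ((id ⊗₁ flatten v T) ∘ α))
      ≈⟨ trans≈ assoc (∘ʳ (trans≈ assoc (∘ʳ (cancelInv (unflatten-flatten u _))))) ⟩
    α⁻¹ ∘ ((id ⊗₁ unflatten v T) ∘ ((id ⊗₁ flatten v T) ∘ α))
      ≈⟨ ∘ʳ (pullˡ (id⊗-inverse (unflatten-flatten v T))) ⟩
    α⁻¹ ∘ (id ∘ α) ≈⟨ ∘ʳ identityˡ ⟩
    α⁻¹ ∘ α ≈⟨ α-isoˡ ⟩
    id ∎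

  flatten-natural : ∀ w {T T'} (g : Hom T T') → (flatten w T' ∘ (id ⊗₁ g)) ≈ (push₁ w g ∘ flatten w T)
  flatten-natural (atom a) g = trans≈ identityˡ (sym≈ identityʳ)
  flatten-natural unit g = unitorˡ-natural
  flatten-natural (u ⊗w v) {T} {T'} g = begin
    (flatten u _ ∘ ((id ⊗₁ flatten v T') ∘ α)) ∘ (id ⊗₁ g)
      ≈⟨ trans≈ assoc (∘ʳ (trans≈ assoc (∘ʳ (∘ʳ (⊗ˡ id⊗id))))) ⟩
    flatten u _ ∘ ((id ⊗₁ flatten v T') ∘ (α ∘ ((id ⊗₁ id) ⊗₁ g)))
      ≈⟨ ∘ʳ (∘ʳ α-natural) ⟩
    flatten u _ ∘ ((id ⊗₁ flatten v T') ∘ ((id ⊗₁ (id ⊗₁ g)) ∘ α))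
      ≈⟨ ∘ʳ (pullˡ (sym≈ id⊗∘)) ⟩
    flatten u _ ∘ ((id ⊗₁ (flatten v T' ∘ (id ⊗₁ g))) ∘ α)
      ≈⟨ ∘ʳ (∘ˡ (⊗ʳ (flatten-natural v g))) ⟩
    flatten u _ ∘ ((id ⊗₁ (push₁ v g ∘ flatten v T)) ∘ α)
      ≈⟨ ∘ʳ (∘ˡ id⊗∘) ⟩
    flatten u _ ∘ (((id ⊗₁ push₁ v g) ∘ (id ⊗₁ flatten v T)) ∘ α)
      ≈⟨ trans≈ (∘ʳ assoc) sym-assoc ⟩
    (flatten u _ ∘ (id ⊗₁ push₁ v g)) ∘ ((id ⊗₁ flatten v T) ∘ α)
      ≈⟨ ∘ˡ (flatten-natural u (push₁ v g)) ⟩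
    (push₁ u (push₁ v g) ∘ flatten u _) ∘ ((id ⊗₁ flatten v T) ∘ α)
      ≈⟨ assoc ⟩
    push₁ u (push₁ v g) ∘ (flatten u _ ∘ ((id ⊗₁ flatten v T) ∘ α)) ∎

  unflatten-natural : ∀ w {T T'} (g : Hom T T') → (unflatten w T' ∘ push₁ w g) ≈ ((id ⊗₁ g) ∘ unflatten w T)
  unflatten-natural w g = sym≈ (inverse-square (unflatten-flatten w _) (flatten-unflatten w _) (flatten-natural w g))

  strictify : (u v : Word) → Hom ⟦ u ⟧w ⟦ v ⟧w → (T : Obj) → Hom (push u T) (push v T)
  strictify u v s T = flatten v T ∘ ((s ⊗₁ id) ∘ unflatten u T)

  strictify-resp : ∀ u v {s s'} T → s ≈ s' → strictify u v s T ≈ strictify u v s' T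
  strictify-resp u v T p = ∘ʳ (∘ˡ (⊗ˡ p))

  strictify-id : ∀ u T → strictify u u id T ≈ id
  strictify-id u T = trans≈ (∘ʳ (trans≈ (∘ˡ ⊗-identity) identityˡ)) (flatten-unflatten u T)

  strictify-∘ : ∀ u v w T {s : Hom ⟦ v ⟧w ⟦ w ⟧w} {t : Hom ⟦ u ⟧w ⟦ v ⟧w} →
          strictify u w (s ∘ t) T ≈ (strictify v w s T ∘ strictify u v t T)
  strictify-∘ u v w T {s} {t} = begin
    flatten w T ∘ (((s ∘ t) ⊗₁ id) ∘ unflatten u T) ≈⟨ ∘ʳ (∘ˡ ∘⊗id) ⟩
    flatten w T ∘ (((s ⊗₁ id) ∘ (t ⊗₁ id)) ∘ unflatten u T) ≈⟨ ∘ʳ assoc ⟩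
    flatten w T ∘ ((s ⊗₁ id) ∘ ((t ⊗₁ id) ∘ unflatten u T)) ≈˘⟨ ∘ʳ (∘ʳ (trans≈ (∘ˡ (unflatten-flatten v T)) identityˡ)) ⟩
    flatten w T ∘ ((s ⊗₁ id) ∘ ((unflatten v T ∘ flatten v T) ∘ ((t ⊗₁ id) ∘ unflatten u T))) ≈⟨ ∘ʳ (∘ʳ assoc) ⟩
    flatten w T ∘ ((s ⊗₁ id) ∘ (unflatten v T ∘ (flatten v T ∘ ((t ⊗₁ id) ∘ unflatten u T)))) ≈⟨ ∘ʳ sym-assoc ⟩
    flatten w T ∘ (((s ⊗₁ id) ∘ unflatten v T) ∘ (flatten v T ∘ ((t ⊗₁ id) ∘ unflatten u T))) ≈⟨ sym-assoc ⟩
    (flatten w T ∘ ((s ⊗₁ id) ∘ unflatten v T)) ∘ (flatten v T ∘ ((t ⊗₁ id) ∘ unflatten u T)) ∎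

  strictify-⊗ : ∀ u u' v v' T {s : Hom ⟦ u ⟧w ⟦ v ⟧w} {t : Hom ⟦ u' ⟧w ⟦ v' ⟧w} →
          strictify (u ⊗w u') (v ⊗w v') (s ⊗₁ t) T ≈ (strictify u v s (push v' T) ∘ push₁ u (strictify u' v' t T))
  strictify-⊗ u u' v v' T {s} {t} = begin
    (flatten v _ ∘ ((id ⊗₁ flatten v' T) ∘ α)) ∘ (((s ⊗₁ t) ⊗₁ id) ∘ (α⁻¹ ∘ ((id ⊗₁ unflatten u' T) ∘ unflatten u _)))
      ≈⟨ trans≈ assoc (∘ʳ (trans≈ assoc (∘ʳ (pullˡ α-natural)))) ⟩
    flatten v _ ∘ ((id ⊗₁ flatten v' T) ∘ (((s ⊗₁ (t ⊗₁ id)) ∘ α) ∘ (α⁻¹ ∘ ((id ⊗₁ unflatten u' T) ∘ unflatten u _))))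
      ≈⟨ ∘ʳ (∘ʳ (trans≈ assoc (∘ʳ (cancelInv α-isoʳ)))) ⟩
    flatten v _ ∘ ((id ⊗₁ flatten v' T) ∘ ((s ⊗₁ (t ⊗₁ id)) ∘ ((id ⊗₁ unflatten u' T) ∘ unflatten u _)))
      ≈⟨ ∘ʳ (trans≈ (pullˡ (sym≈ ⊗-homomorphism)) (pullˡ (sym≈ ⊗-homomorphism))) ⟩
    flatten v _ ∘ ((((id ∘ s) ∘ id) ⊗₁ ((flatten v' T ∘ (t ⊗₁ id)) ∘ unflatten u' T)) ∘ unflatten u _)
      ≈⟨ ∘ʳ (∘ˡ (⊗-resp-≈ (trans≈ identityʳ (trans≈ identityˡ (sym≈ identityʳ))) (trans≈ assoc (sym≈ identityˡ)))) ⟩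
    flatten v _ ∘ (((s ∘ id) ⊗₁ (id ∘ strictify u' v' t T)) ∘ unflatten u _)
      ≈⟨ ∘ʳ (∘ˡ ⊗-homomorphism) ⟩
    flatten v _ ∘ (((s ⊗₁ id) ∘ (id ⊗₁ strictify u' v' t T)) ∘ unflatten u _)
      ≈⟨ ∘ʳ assoc ⟩
    flatten v _ ∘ ((s ⊗₁ id) ∘ ((id ⊗₁ strictify u' v' t T) ∘ unflatten u _))
      ≈˘⟨ ∘ʳ (∘ʳ (unflatten-natural u _)) ⟩
    flatten v _ ∘ ((s ⊗₁ id) ∘ (unflatten u _ ∘ push₁ u (strictify u' v' t T)))
      ≈⟨ trans≈ (∘ʳ sym-assoc) sym-assoc ⟩
    strictify u v s _ ∘ push₁ u (strictify u' v' t T) ∎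

  into-id∘ : ∀ {A B} {f : Hom A B} {g : Hom A B} → f ≈ g → f ≈ (id ∘ g)
  into-id∘ p = trans≈ p (sym≈ identityˡ)

  strictify-square : ∀ u v T {s : Hom ⟦ u ⟧w ⟦ v ⟧w} {φ : Hom (push u T) (push v T)} →
              (flatten v T ∘ (s ⊗₁ id)) ≈ (φ ∘ flatten u T) → strictify u v s T ≈ φ
  strictify-square u v T p = trans≈ sym-assoc (trans≈ (∘ˡ p) (trans≈ assoc (trans≈ (∘ʳ (flatten-unflatten u T)) identityʳ)))

  strictify-inverse : ∀ u v T {s : Hom ⟦ u ⟧w ⟦ v ⟧w} {s' : Hom ⟦ v ⟧w ⟦ u ⟧w}
            {φ : Hom (push u T) (push v T)} {ψ : Hom (push v T) (push u T)} →
            strictify u v s T ≈ φ → (s ∘ s') ≈ id → (ψ ∘ φ) ≈ id → strictify v u s' T ≈ ψ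
  strictify-inverse u v T {s} {s'} {φ} {ψ} p q r = begin
    strictify v u s' T                  ≈˘⟨ identityˡ ⟩
    id ∘ strictify v u s' T             ≈˘⟨ ∘ˡ r ⟩
    (ψ ∘ φ) ∘ strictify v u s' T        ≈⟨ assoc ⟩
    ψ ∘ (φ ∘ strictify v u s' T)        ≈˘⟨ ∘ʳ (∘ˡ p) ⟩
    ψ ∘ (strictify u v s T ∘ strictify v u s' T)    ≈˘⟨ ∘ʳ (strictify-∘ v u v T) ⟩
    ψ ∘ strictify v v (s ∘ s') T            ≈⟨ ∘ʳ (strictify-resp v v T q) ⟩
    ψ ∘ strictify v v id T                  ≈⟨ ∘ʳ (strictify-id v T) ⟩
    ψ ∘ id ≈⟨ identityʳ ⟩
    ψ ∎

  strictify-α : ∀ u v w T → strictify ((u ⊗w v) ⊗w w) (u ⊗w (v ⊗w w)) α T ≈ id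
  strictify-α u v w T = strictify-square ((u ⊗w v) ⊗w w) (u ⊗w (v ⊗w w)) T (into-id∘ (begin
    (cu ∘ ((id ⊗₁ (cv ∘ ((id ⊗₁ cw) ∘ α))) ∘ α)) ∘ (α ⊗₁ id)
      ≈⟨ trans≈ assoc (∘ʳ assoc) ⟩
    cu ∘ ((id ⊗₁ (cv ∘ ((id ⊗₁ cw) ∘ α))) ∘ (α ∘ (α ⊗₁ id)))
      ≈⟨ ∘ʳ (∘ˡ (trans≈ id⊗∘ (∘ʳ id⊗∘))) ⟩
    cu ∘ (((id ⊗₁ cv) ∘ ((id ⊗₁ (id ⊗₁ cw)) ∘ (id ⊗₁ α))) ∘ (α ∘ (α ⊗₁ id)))
      ≈⟨ ∘ʳ (trans≈ assoc (∘ʳ assoc)) ⟩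
    cu ∘ ((id ⊗₁ cv) ∘ ((id ⊗₁ (id ⊗₁ cw)) ∘ ((id ⊗₁ α) ∘ (α ∘ (α ⊗₁ id)))))
      ≈˘⟨ ∘ʳ (∘ʳ (∘ʳ pentagon)) ⟩
    cu ∘ ((id ⊗₁ cv) ∘ ((id ⊗₁ (id ⊗₁ cw)) ∘ (α ∘ α)))
      ≈⟨ ∘ʳ (∘ʳ (pullˡ (sym≈ α-natural))) ⟩
    cu ∘ ((id ⊗₁ cv) ∘ ((α ∘ ((id ⊗₁ id) ⊗₁ cw)) ∘ α))
      ≈⟨ ∘ʳ (∘ʳ (trans≈ assoc (∘ʳ (∘ˡ (⊗ˡ ⊗-identity))))) ⟩
    cu ∘ ((id ⊗₁ cv) ∘ (α ∘ ((id ⊗₁ cw) ∘ α)))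
      ≈⟨ trans≈ (∘ʳ sym-assoc) sym-assoc ⟩
    (cu ∘ ((id ⊗₁ cv) ∘ α)) ∘ ((id ⊗₁ cw) ∘ α) ∎))
    where
    cu : Hom (⟦ u ⟧w ⊗₀ push v (push w T)) (push u (push v (push w T)))
    cu = flatten u (push v (push w T))
    cv : Hom (⟦ v ⟧w ⊗₀ push w T) (push v (push w T))
    cv = flatten v (push w T)
    cw : Hom (⟦ w ⟧w ⊗₀ T) (push w T)
    cw = flatten w T

  strictify-α⁻¹ : ∀ u v w T → strictify (u ⊗w (v ⊗w w)) ((u ⊗w v) ⊗w w) α⁻¹ T ≈ id
  strictify-α⁻¹ u v w T = strictify-inverse ((u ⊗w v) ⊗w w) (u ⊗w (v ⊗w w)) T (strictify-α u v w T) α-isoʳ identityˡ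

  strictify-λ : ∀ u T → strictify (unit ⊗w u) u unitorˡ T ≈ id
  strictify-λ u T = strictify-square (unit ⊗w u) u T (into-id∘ (begin
    flatten u T ∘ (unitorˡ ⊗₁ id) ≈˘⟨ ∘ʳ unitorˡ-α ⟩
    flatten u T ∘ (unitorˡ ∘ α) ≈⟨ sym-assoc ⟩
    (flatten u T ∘ unitorˡ) ∘ α ≈˘⟨ ∘ˡ unitorˡ-natural ⟩
    (unitorˡ ∘ (id ⊗₁ flatten u T)) ∘ α ≈⟨ assoc ⟩
    unitorˡ ∘ ((id ⊗₁ flatten u T) ∘ α) ∎))

  strictify-λ⁻¹ : ∀ u T → strictify u (unit ⊗w u) unitorˡ⁻¹ T ≈ id
  strictify-λ⁻¹ u T = strictify-inverse (unit ⊗w u) u T (strictify-λ u T) unitorˡ-isoʳ identityˡ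

  strictify-ρ : ∀ u T → strictify (u ⊗w unit) u unitorʳ T ≈ id
  strictify-ρ u T = strictify-square (u ⊗w unit) u T (into-id∘ (∘ʳ (sym≈ triangle)))

  strictify-ρ⁻¹ : ∀ u T → strictify u (u ⊗w unit) unitorʳ⁻¹ T ≈ id
  strictify-ρ⁻¹ u T = strictify-inverse (u ⊗w unit) u T (strictify-ρ u T) unitorʳ-isoʳ identityˡ

  sw : ∀ {a b T} → Hom (a ⊗₀ (b ⊗₀ T)) (b ⊗₀ (a ⊗₀ T))
  sw = α ∘ ((σ ⊗₁ id) ∘ α⁻¹)

  swapAtom : (a : Obj) (v : Word) (T : Obj) → Hom (a ⊗₀ push v T) (push v (a ⊗₀ T))
  swapAtom a (atom b) T = sw
  swapAtom a unit T = id
  swapAtom a (v1 ⊗w v2) T = push₁ v1 (swapAtom a v2 T) ∘ swapAtom a v1 (push v2 T)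

  swapBlock : (u v : Word) (T : Obj) → Hom (push u (push v T)) (push v (push u T))
  swapBlock (atom a) v T = swapAtom a v T
  swapBlock unit v T = id
  swapBlock (u1 ⊗w u2) v T = swapBlock u1 v (push u2 T) ∘ push₁ u1 (swapBlock u2 v T)

  -- strictify distributes over a composite of five morphisms (the shape of
  -- the formulas σ-⊗ˡ and σ-⊗ʳ).
  strictify-∘⁵ : ∀ w0 w1 w2 w3 w4 w5 T {a : Hom ⟦ w4 ⟧w ⟦ w5 ⟧w} {b : Hom ⟦ w3 ⟧w ⟦ w4 ⟧w}
         {c : Hom ⟦ w2 ⟧w ⟦ w3 ⟧w} {d : Hom ⟦ w1 ⟧w ⟦ w2 ⟧w} {f : Hom ⟦ w0 ⟧w ⟦ w1 ⟧w} →
         strictify w0 w5 (a ∘ (b ∘ (c ∘ (d ∘ f)))) T ≈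
         (strictify w4 w5 a T ∘ (strictify w3 w4 b T ∘ (strictify w2 w3 c T ∘ (strictify w1 w2 d T ∘ strictify w0 w1 f T))))
  strictify-∘⁵ w0 w1 w2 w3 w4 w5 T =
    trans≈ (strictify-∘ w0 w4 w5 T) (∘ʳ (trans≈ (strictify-∘ w0 w3 w4 T) (∘ʳ (trans≈ (strictify-∘ w0 w2 w3 T) (∘ʳ (strictify-∘ w0 w1 w2 T))))))

  strictify-σ : ∀ u v T → strictify (u ⊗w v) (v ⊗w u) σ T ≈ swapBlock u v T
  strictify-σ-atom : ∀ a v T → strictify (atom a ⊗w v) (v ⊗w atom a) σ T ≈ swapAtom a v T
  strictify-σ unit v T = begin
    strictify (unit ⊗w v) (v ⊗w unit) σ T ≈⟨ strictify-resp (unit ⊗w v) (v ⊗w unit) T σ-unitˡ ⟩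
    strictify (unit ⊗w v) (v ⊗w unit) (unitorʳ⁻¹ ∘ unitorˡ) T ≈⟨ strictify-∘ (unit ⊗w v) v (v ⊗w unit) T ⟩
    strictify v (v ⊗w unit) unitorʳ⁻¹ T ∘ strictify (unit ⊗w v) v unitorˡ T ≈⟨ ∘-resp-≈ (strictify-ρ⁻¹ v T) (strictify-λ v T) ⟩
    id ∘ id ≈⟨ identityˡ ⟩
    id ∎
  strictify-σ (atom a) v T = strictify-σ-atom a v T
  strictify-σ (u1 ⊗w u2) v T = begin
    strictify ((u1 ⊗w u2) ⊗w v) (v ⊗w (u1 ⊗w u2)) σ T
      ≈⟨ strictify-resp ((u1 ⊗w u2) ⊗w v) (v ⊗w (u1 ⊗w u2)) T σ-⊗ˡ ⟩
    strictify ((u1 ⊗w u2) ⊗w v) (v ⊗w (u1 ⊗w u2)) (α ∘ ((σ ⊗₁ id) ∘ (α⁻¹ ∘ ((id ⊗₁ σ) ∘ α)))) T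
      ≈⟨ strictify-∘⁵ ((u1 ⊗w u2) ⊗w v) (u1 ⊗w (u2 ⊗w v)) (u1 ⊗w (v ⊗w u2)) ((u1 ⊗w v) ⊗w u2) ((v ⊗w u1) ⊗w u2) (v ⊗w (u1 ⊗w u2)) T ⟩
    _ ∘ (_ ∘ (_ ∘ (_ ∘ _)))
      ≈⟨ ∘-resp-≈ (strictify-α v u1 u2 T) (∘-resp-≈ (strictify-⊗ (u1 ⊗w v) u2 (v ⊗w u1) u2 T) (∘-resp-≈ (strictify-α⁻¹ u1 v u2 T) (∘-resp-≈ (strictify-⊗ u1 (u2 ⊗w v) u1 (v ⊗w u2) T) (strictify-α u1 u2 v T)))) ⟩
    id ∘ ((strictify (u1 ⊗w v) (v ⊗w u1) σ (push u2 T) ∘ push₁ (u1 ⊗w v) (strictify u2 u2 id T)) ∘ (id ∘ ((strictify u1 u1 id (push (v ⊗w u2) T) ∘ push₁ u1 (strictify (u2 ⊗w v) (v ⊗w u2) σ T)) ∘ id)))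
      ≈⟨ trans≈ identityˡ (∘-resp-≈ (∘-resp-≈ (strictify-σ u1 v (push u2 T)) (trans≈ (push₁-resp (u1 ⊗w v) (strictify-id u2 T)) (push₁-id (u1 ⊗w v)))) (trans≈ identityˡ (trans≈ identityʳ (∘-resp-≈ (strictify-id u1 _) (push₁-resp u1 (strictify-σ u2 v T)))))) ⟩
    (swapBlock u1 v (push u2 T) ∘ id) ∘ (id ∘ push₁ u1 (swapBlock u2 v T))
      ≈⟨ ∘-resp-≈ identityʳ identityˡ ⟩
    swapBlock u1 v (push u2 T) ∘ push₁ u1 (swapBlock u2 v T) ∎
  strictify-σ-atom a unit T = begin
    strictify (atom a ⊗w unit) (unit ⊗w atom a) σ T ≈⟨ strictify-resp (atom a ⊗w unit) (unit ⊗w atom a) T σ-unitʳ ⟩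
    strictify (atom a ⊗w unit) (unit ⊗w atom a) (unitorˡ⁻¹ ∘ unitorʳ) T ≈⟨ strictify-∘ (atom a ⊗w unit) (atom a) (unit ⊗w atom a) T ⟩
    strictify (atom a) (unit ⊗w atom a) unitorˡ⁻¹ T ∘ strictify (atom a ⊗w unit) (atom a) unitorʳ T ≈⟨ ∘-resp-≈ (strictify-λ⁻¹ (atom a) T) (strictify-ρ (atom a) T) ⟩
    id ∘ id ≈⟨ identityˡ ⟩
    id ∎
  strictify-σ-atom a (atom b) T = ∘-resp-≈ (trans≈ identityˡ (trans≈ (∘ˡ ⊗-identity) identityˡ))
                        (∘ʳ (trans≈ (∘ʳ (trans≈ identityʳ ⊗-identity)) identityʳ))
  strictify-σ-atom a (v1 ⊗w v2) T = begin
    strictify (atom a ⊗w (v1 ⊗w v2)) ((v1 ⊗w v2) ⊗w atom a) σ T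
      ≈⟨ strictify-resp (atom a ⊗w (v1 ⊗w v2)) ((v1 ⊗w v2) ⊗w atom a) T σ-⊗ʳ ⟩
    strictify (atom a ⊗w (v1 ⊗w v2)) ((v1 ⊗w v2) ⊗w atom a) (α⁻¹ ∘ ((id ⊗₁ σ) ∘ (α ∘ ((σ ⊗₁ id) ∘ α⁻¹)))) T
      ≈⟨ strictify-∘⁵ (atom a ⊗w (v1 ⊗w v2)) ((atom a ⊗w v1) ⊗w v2) ((v1 ⊗w atom a) ⊗w v2) (v1 ⊗w (atom a ⊗w v2)) (v1 ⊗w (v2 ⊗w atom a)) ((v1 ⊗w v2) ⊗w atom a) T ⟩
    _ ∘ (_ ∘ (_ ∘ (_ ∘ _)))
      ≈⟨ ∘-resp-≈ (strictify-α⁻¹ v1 v2 (atom a) T) (∘-resp-≈ (strictify-⊗ v1 (atom a ⊗w v2) v1 (v2 ⊗w atom a) T) (∘-resp-≈ (strictify-α v1 (atom a) v2 T) (∘-resp-≈ (strictify-⊗ (atom a ⊗w v1) v2 (v1 ⊗w atom a) v2 T) (strictify-α⁻¹ (atom a) v1 v2 T)))) ⟩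
    id ∘ ((strictify v1 v1 id _ ∘ push₁ v1 (strictify (atom a ⊗w v2) (v2 ⊗w atom a) σ T)) ∘ (id ∘ ((strictify (atom a ⊗w v1) (v1 ⊗w atom a) σ (push v2 T) ∘ push₁ (atom a ⊗w v1) (strictify v2 v2 id T)) ∘ id)))
      ≈⟨ trans≈ identityˡ (∘-resp-≈ (∘-resp-≈ (strictify-id v1 _) (push₁-resp v1 (strictify-σ-atom a v2 T))) (trans≈ identityˡ (trans≈ identityʳ (∘-resp-≈ (strictify-σ-atom a v1 _) (trans≈ (push₁-resp (atom a ⊗w v1) (strictify-id v2 T)) (push₁-id (atom a ⊗w v1))))))) ⟩
    (id ∘ push₁ v1 (swapAtom a v2 T)) ∘ (swapAtom a v1 (push v2 T) ∘ id)
      ≈⟨ ∘-resp-≈ identityˡ identityʳ ⟩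
    push₁ v1 (swapAtom a v2 T) ∘ swapAtom a v1 (push v2 T) ∎

  infixr 9 _∘T_
  infixr 10 _⊗T_
  data Term : Word → Word → Set (o ⊔ ℓ) where
    idT  : ∀ {u} → Term u u
    _∘T_ : ∀ {u v w} → Term v w → Term u v → Term u w
    _⊗T_ : ∀ {u u' v v'} → Term u v → Term u' v' → Term (u ⊗w u') (v ⊗w v')
    αT   : ∀ {u v w} → Term ((u ⊗w v) ⊗w w) (u ⊗w (v ⊗w w))
    α⁻¹T : ∀ {u v w} → Term (u ⊗w (v ⊗w w)) ((u ⊗w v) ⊗w w)
    λT   : ∀ {u} → Term (unit ⊗w u) u
    λ⁻¹T : ∀ {u} → Term u (unit ⊗w u)
    ρT   : ∀ {u} → Term (u ⊗w unit) u
    ρ⁻¹T : ∀ {u} → Term u (u ⊗w unit)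
    σT   : ∀ {u v} → Term (u ⊗w v) (v ⊗w u)
    gen  : ∀ {u v} → Hom ⟦ u ⟧w ⟦ v ⟧w → Term u v

  ⟦_⟧T : ∀ {u v} → Term u v → Hom ⟦ u ⟧w ⟦ v ⟧w
  ⟦ idT ⟧T = id
  ⟦ s ∘T t ⟧T = ⟦ s ⟧T ∘ ⟦ t ⟧T
  ⟦ s ⊗T t ⟧T = ⟦ s ⟧T ⊗₁ ⟦ t ⟧T
  ⟦ αT ⟧T = α
  ⟦ α⁻¹T ⟧T = α⁻¹
  ⟦ λT ⟧T = unitorˡ
  ⟦ λ⁻¹T ⟧T = unitorˡ⁻¹
  ⟦ ρT ⟧T = unitorʳ
  ⟦ ρ⁻¹T ⟧T = unitorʳ⁻¹
  ⟦ σT ⟧T = σ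
  ⟦ gen f ⟧T = f

  strict : ∀ {u v} → Term u v → (T : Obj) → Hom (push u T) (push v T)
  strict idT T = id
  strict (s ∘T t) T = strict s T ∘ strict t T
  strict (_⊗T_ {u} {u'} {v} {v'} s t) T = strict s (push v' T) ∘ push₁ u (strict t T)
  strict αT T = id
  strict α⁻¹T T = id
  strict λT T = id
  strict λ⁻¹T T = id
  strict ρT T = id
  strict ρ⁻¹T T = id
  strict (σT {u} {v}) T = swapBlock u v T
  strict (gen {u} {v} f) T = strictify u v f T

  strict-sound : ∀ {u v} (t : Term u v) T → strictify u v ⟦ t ⟧T T ≈ strict t T
  strict-sound {u} idT T = strictify-id u T
  strict-sound (_∘T_ {u} {v} {w} s t) T = trans≈ (strictify-∘ u v w T) (∘-resp-≈ (strict-sound s T) (strict-sound t T))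
  strict-sound (_⊗T_ {u} {u'} {v} {v'} s t) T =
    trans≈ (strictify-⊗ u u' v v' T) (∘-resp-≈ (strict-sound s _) (push₁-resp u (strict-sound t T)))
  strict-sound (αT {u} {v} {w}) T = strictify-α u v w T
  strict-sound (α⁻¹T {u} {v} {w}) T = strictify-α⁻¹ u v w T
  strict-sound (λT {u}) T = strictify-λ u T
  strict-sound (λ⁻¹T {u}) T = strictify-λ⁻¹ u T
  strict-sound (ρT {u}) T = strictify-ρ u T
  strict-sound (ρ⁻¹T {u}) T = strictify-ρ⁻¹ u T
  strict-sound (σT {u} {v}) T = strictify-σ u v T
  strict-sound (gen f) T = refl≈

  strictify-reflects : ∀ u v {s s' : Hom ⟦ u ⟧w ⟦ v ⟧w} → strictify u v s 𝟙 ≈ strictify u v s' 𝟙 → s ≈ s'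
  strictify-reflects u v {s} {s'} p = ⊗𝟙-faithful (trans≈ (sym≈ (ex s)) (trans≈ (∘ʳ (∘ˡ p)) (ex s')))
    where
    ex : ∀ x → (unflatten v 𝟙 ∘ (strictify u v x 𝟙 ∘ flatten u 𝟙)) ≈ (x ⊗₁ id)
    ex x = begin
      unflatten v 𝟙 ∘ ((flatten v 𝟙 ∘ ((x ⊗₁ id) ∘ unflatten u 𝟙)) ∘ flatten u 𝟙) ≈⟨ ∘ʳ assoc ⟩
      unflatten v 𝟙 ∘ (flatten v 𝟙 ∘ (((x ⊗₁ id) ∘ unflatten u 𝟙) ∘ flatten u 𝟙)) ≈⟨ cancelInv (unflatten-flatten v 𝟙) ⟩
      ((x ⊗₁ id) ∘ unflatten u 𝟙) ∘ flatten u 𝟙 ≈⟨ assoc ⟩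
      (x ⊗₁ id) ∘ (unflatten u 𝟙 ∘ flatten u 𝟙) ≈⟨ ∘ʳ (unflatten-flatten u 𝟙) ⟩
      (x ⊗₁ id) ∘ id ≈⟨ identityʳ ⟩
      x ⊗₁ id ∎

  coherence : ∀ {u v} (t t' : Term u v) → strict t 𝟙 ≈ strict t' 𝟙 → ⟦ t ⟧T ≈ ⟦ t' ⟧T
  coherence {u} {v} t t' p = strictify-reflects u v (trans≈ (strict-sound t 𝟙) (trans≈ p (sym≈ (strict-sound t' 𝟙))))

  strict-natural : ∀ {u v} (t : Term u v) {T T'} (g : Hom T T') → (strict t T' ∘ push₁ u g) ≈ (push₁ v g ∘ strict t T)
  strict-natural {u} {v} t {T} {T'} g = begin
    strict t T' ∘ push₁ u g ≈˘⟨ ∘ˡ (strict-sound t T') ⟩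
    (flatten v T' ∘ ((x ⊗₁ id) ∘ unflatten u T')) ∘ push₁ u g ≈⟨ trans≈ assoc (∘ʳ (trans≈ assoc (∘ʳ (unflatten-natural u g)))) ⟩
    flatten v T' ∘ ((x ⊗₁ id) ∘ ((id ⊗₁ g) ∘ unflatten u T)) ≈⟨ ∘ʳ (pullˡ slide) ⟩
    flatten v T' ∘ (((id ⊗₁ g) ∘ (x ⊗₁ id)) ∘ unflatten u T) ≈⟨ trans≈ (∘ʳ assoc) sym-assoc ⟩
    (flatten v T' ∘ (id ⊗₁ g)) ∘ ((x ⊗₁ id) ∘ unflatten u T) ≈⟨ ∘ˡ (flatten-natural v g) ⟩
    (push₁ v g ∘ flatten v T) ∘ ((x ⊗₁ id) ∘ unflatten u T) ≈⟨ assoc ⟩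
    push₁ v g ∘ strictify u v x T ≈⟨ ∘ʳ (strict-sound t T) ⟩
    push₁ v g ∘ strict t T ∎
    where x = ⟦ t ⟧T

  infixr 5 _∷_ _++c_
  data Chain : Obj → Obj → Set (o ⊔ ℓ) where
    []  : ∀ {A} → Chain A A
    _∷_ : ∀ {A B D} → Hom B D → Chain A B → Chain A D

  ⟦_⟧c : ∀ {A B} → Chain A B → Hom A B
  ⟦ [] ⟧c = id
  ⟦ h ∷ c ⟧c = h ∘ ⟦ c ⟧c

  _++c_ : ∀ {A B D} → Chain B D → Chain A B → Chain A D
  [] ++c d = d
  (h ∷ c) ++c d = h ∷ (c ++c d)

  pushChain : (w : Word) → ∀ {A B} → Chain A B → Chain (push w A) (push w B)
  pushChain w [] = []
  pushChain w (h ∷ c) = push₁ w h ∷ pushChain w c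

  ++c-sound : ∀ {A B D} (c : Chain B D) (d : Chain A B) → ⟦ c ++c d ⟧c ≈ (⟦ c ⟧c ∘ ⟦ d ⟧c)
  ++c-sound [] d = sym≈ identityˡ
  ++c-sound (h ∷ c) d = trans≈ (∘ʳ (++c-sound c d)) sym-assoc

  pushChain-sound : ∀ w {A B} (c : Chain A B) → ⟦ pushChain w c ⟧c ≈ push₁ w ⟦ c ⟧c
  pushChain-sound w [] = sym≈ (push₁-id w)
  pushChain-sound w (h ∷ c) = trans≈ (∘ʳ (pushChain-sound w c)) (sym≈ (push₁-∘ w))

  swapAtomChain : (a : Obj) (v : Word) (T : Obj) → Chain (a ⊗₀ push v T) (push v (a ⊗₀ T))
  swapAtomChain a (atom b) T = sw ∷ []
  swapAtomChain a unit T = []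
  swapAtomChain a (v1 ⊗w v2) T = pushChain v1 (swapAtomChain a v2 T) ++c swapAtomChain a v1 (push v2 T)

  swapChain : (u v : Word) (T : Obj) → Chain (push u (push v T)) (push v (push u T))
  swapChain (atom a) v T = swapAtomChain a v T
  swapChain unit v T = []
  swapChain (u1 ⊗w u2) v T = swapChain u1 v (push u2 T) ++c pushChain u1 (swapChain u2 v T)

  swapAtomChain-sound : ∀ a v T → ⟦ swapAtomChain a v T ⟧c ≈ swapAtom a v T
  swapAtomChain-sound a (atom b) T = identityʳ
  swapAtomChain-sound a unit T = refl≈
  swapAtomChain-sound a (v1 ⊗w v2) T = trans≈ (++c-sound (pushChain v1 (swapAtomChain a v2 T)) (swapAtomChain a v1 (push v2 T)))
    (∘-resp-≈ (trans≈ (pushChain-sound v1 (swapAtomChain a v2 T)) (push₁-resp v1 (swapAtomChain-sound a v2 T))) (swapAtomChain-sound a v1 _))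

  swapChain-sound : ∀ u v T → ⟦ swapChain u v T ⟧c ≈ swapBlock u v T
  swapChain-sound (atom a) v T = swapAtomChain-sound a v T
  swapChain-sound unit v T = refl≈
  swapChain-sound (u1 ⊗w u2) v T = trans≈ (++c-sound (swapChain u1 v (push u2 T)) (pushChain u1 (swapChain u2 v T)))
    (∘-resp-≈ (swapChain-sound u1 v _) (trans≈ (pushChain-sound u1 (swapChain u2 v T)) (push₁-resp u1 (swapChain-sound u2 v T))))

  chainOf : ∀ {u v} → Term u v → (T : Obj) → Chain (push u T) (push v T)
  chainOf idT T = []
  chainOf (s ∘T t) T = chainOf s T ++c chainOf t T
  chainOf (_⊗T_ {u} {u'} {v} {v'} s t) T = chainOf s (push v' T) ++c pushChain u (chainOf t T)
  chainOf αT T = []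
  chainOf α⁻¹T T = []
  chainOf λT T = []
  chainOf λ⁻¹T T = []
  chainOf ρT T = []
  chainOf ρ⁻¹T T = []
  chainOf (σT {u} {v}) T = swapChain u v T
  chainOf (gen {u} {v} f) T = strictify u v f T ∷ []

  chainOf-sound : ∀ {u v} (t : Term u v) T → ⟦ chainOf t T ⟧c ≈ strict t T
  chainOf-sound idT T = refl≈
  chainOf-sound (s ∘T t) T = trans≈ (++c-sound (chainOf s T) (chainOf t T)) (∘-resp-≈ (chainOf-sound s T) (chainOf-sound t T))
  chainOf-sound (_⊗T_ {u} {u'} {v} {v'} s t) T = trans≈ (++c-sound (chainOf s (push v' T)) (pushChain u (chainOf t T)))
    (∘-resp-≈ (chainOf-sound s _) (trans≈ (pushChain-sound u (chainOf t T)) (push₁-resp u (chainOf-sound t T))))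
  chainOf-sound αT T = refl≈
  chainOf-sound α⁻¹T T = refl≈
  chainOf-sound λT T = refl≈
  chainOf-sound λ⁻¹T T = refl≈
  chainOf-sound ρT T = refl≈
  chainOf-sound ρ⁻¹T T = refl≈
  chainOf-sound (σT {u} {v}) T = swapChain-sound u v T
  chainOf-sound (gen f) T = identityʳ

  coherence-chain : ∀ {u v} (t t' : Term u v) → ⟦ chainOf t 𝟙 ⟧c ≈ ⟦ chainOf t' 𝟙 ⟧c → ⟦ t ⟧T ≈ ⟦ t' ⟧T
  coherence-chain t t' p = coherence t t' (trans≈ (sym≈ (chainOf-sound t 𝟙)) (trans≈ p (chainOf-sound t' 𝟙)))

  strict-resp : ∀ {u v} (t t' : Term u v) T → ⟦ t ⟧T ≈ ⟦ t' ⟧T → strict t T ≈ strict t' T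
  strict-resp {u} {v} t t' T p = trans≈ (sym≈ (strict-sound t T)) (trans≈ (strictify-resp u v T p) (strict-sound t' T))

  swap-naturalˡ : ∀ u {v v'} (t : Term v v') T → (swapBlock u v' T ∘ push₁ u (strict t T)) ≈ (strict t (push u T) ∘ swapBlock u v T)
  swap-naturalˡ u {v} {v'} t T =
    trans≈ (∘ʳ (sym≈ identityˡ))
     (trans≈ (strict-resp (σT {u} {v'} ∘T (idT ⊗T t)) ((t ⊗T idT) ∘T σT {u} {v}) T σ-natural)
       (∘ˡ (trans≈ (∘ʳ (push₁-id v)) identityʳ)))

  swap-naturalʳ : ∀ {u u'} v (t : Term u u') T → (swapBlock u' v T ∘ strict t (push v T)) ≈ (push₁ v (strict t T) ∘ swapBlock u v T)
  swap-naturalʳ {u} {u'} v t T =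
    trans≈ (∘ʳ (sym≈ (trans≈ (∘ʳ (push₁-id u)) identityʳ)))
     (trans≈ (strict-resp (σT {u'} {v} ∘T (t ⊗T idT)) ((idT ⊗T t) ∘T σT {u} {v}) T σ-natural)
       (∘ˡ identityˡ))

  swap-inverse : ∀ u v T → (swapBlock v u T ∘ swapBlock u v T) ≈ id
  swap-inverse u v T = strict-resp (σT {v} {u} ∘T σT {u} {v}) idT T σ-involutive

  push₁-square : ∀ pre {A B B' D} {x : Hom B D} {y : Hom A B} {z : Hom B' D} {w : Hom A B'} →
          (x ∘ y) ≈ (z ∘ w) → (push₁ pre x ∘ push₁ pre y) ≈ (push₁ pre z ∘ push₁ pre w)
  push₁-square pre p = trans≈ (sym≈ (push₁-∘ pre)) (trans≈ (push₁-resp pre p) (push₁-∘ pre))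

  commute : ∀ pre {u v} (t : Term u v) {T T'} (g : Hom T T') {A} {r : Hom A (push pre (push u T))} →
        (push₁ pre (strict t T') ∘ (push₁ pre (push₁ u g) ∘ r)) ≈ (push₁ pre (push₁ v g) ∘ (push₁ pre (strict t T) ∘ r))
  commute pre t g = extendʳ (push₁-square pre (strict-natural t g))

  cancel-sw : ∀ pre {a b T A} {r : Hom A (push pre (a ⊗₀ (b ⊗₀ T)))} →
             (push₁ pre (sw {b} {a} {T}) ∘ (push₁ pre (sw {a} {b} {T}) ∘ r)) ≈ r
  cancel-sw pre {a} {b} {T} = cancelInv (trans≈ (sym≈ (push₁-∘ pre)) (trans≈ (push₁-resp pre (swap-inverse (atom a) (atom b) T)) (push₁-id pre)))

  yang-baxter : ∀ {a b c T} → ((sw {b} {c} {a ⊗₀ T} ∘ (id ⊗₁ sw {a} {c} {T})) ∘ sw {a} {b} {c ⊗₀ T}) ≈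
                     ((id ⊗₁ sw {a} {b} {T}) ∘ (sw {a} {c} {b ⊗₀ T} ∘ (id ⊗₁ sw {b} {c} {T})))
  yang-baxter {a} {b} {c} {T} = swap-naturalʳ (atom c) (σT {atom a} {atom b}) T

  push₁-rewrite₃₃ : ∀ pre {A B B' D E E'} {x : Hom B D} {y : Hom B' B} {z : Hom A B'}
                    {w : Hom E D} {v : Hom E' E} {u : Hom A E'} {R} {r : Hom R (push pre A)} →
                    ((x ∘ y) ∘ z) ≈ (w ∘ (v ∘ u)) →
                    (push₁ pre x ∘ (push₁ pre y ∘ (push₁ pre z ∘ r))) ≈ (push₁ pre w ∘ (push₁ pre v ∘ (push₁ pre u ∘ r)))
  push₁-rewrite₃₃ pre {x = x} {y} {z} {w} {v} {u} p =
    trans≈ (∘ʳ sym-assoc) (trans≈ sym-assoc (trans≈ (∘ˡ fused) (trans≈ assoc (∘ʳ assoc))))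
    where
    fused : (push₁ pre x ∘ (push₁ pre y ∘ push₁ pre z)) ≈ (push₁ pre w ∘ (push₁ pre v ∘ push₁ pre u))
    fused = trans≈ (∘ʳ (sym≈ (push₁-∘ pre))) (trans≈ (sym≈ (push₁-∘ pre)) (trans≈ (push₁-resp pre (trans≈ sym-assoc p))
              (trans≈ (push₁-∘ pre) (∘ʳ (push₁-∘ pre)))))
  push₁-rewrite₃₂ : ∀ pre {A B B' D E} {x : Hom B D} {y : Hom B' B} {z : Hom A B'} {w : Hom E D} {v : Hom A E}
                    {R} {r : Hom R (push pre A)} →
                    ((x ∘ y) ∘ z) ≈ (w ∘ v) → (push₁ pre x ∘ (push₁ pre y ∘ (push₁ pre z ∘ r))) ≈ (push₁ pre w ∘ (push₁ pre v ∘ r))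
  push₁-rewrite₃₂ pre p = trans≈ sym-assoc (trans≈ sym-assoc (trans≈ (∘ˡ (trans≈ (∘ˡ (sym≈ (push₁-∘ pre))) (sym≈ (push₁-∘ pre))))
                            (trans≈ (∘ˡ (push₁-resp pre p)) (trans≈ (∘ˡ (push₁-∘ pre)) assoc))))

  yang-baxter-pushed : ∀ pre {a b c T A} {r : Hom A (push pre (a ⊗₀ (b ⊗₀ (c ⊗₀ T))))} →
    (push₁ pre (sw {b} {c} {a ⊗₀ T}) ∘ (push₁ pre (id ⊗₁ sw {a} {c} {T}) ∘ (push₁ pre (sw {a} {b} {c ⊗₀ T}) ∘ r))) ≈
    (push₁ pre (id ⊗₁ sw {a} {b} {T}) ∘ (push₁ pre (sw {a} {c} {b ⊗₀ T}) ∘ (push₁ pre (id ⊗₁ sw {b} {c} {T}) ∘ r)))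
  yang-baxter-pushed pre = push₁-rewrite₃₃ pre yang-baxter

  slide-pair : ∀ pre {a b a' b' c} (t : Term (atom a ⊗w atom b) (atom a' ⊗w atom b')) {T A}
               {r : Hom A (push pre (a ⊗₀ (b ⊗₀ (c ⊗₀ T))))} →
    (push₁ pre (sw {a'} {c} {b' ⊗₀ T}) ∘ (push₁ pre (id ⊗₁ sw {b'} {c} {T}) ∘ (push₁ pre (strict t (c ⊗₀ T)) ∘ r))) ≈
    (push₁ pre (id ⊗₁ strict t T) ∘ (push₁ pre (sw {a} {c} {b ⊗₀ T}) ∘ (push₁ pre (id ⊗₁ sw {b} {c} {T}) ∘ r)))
  slide-pair pre {c = c} t {T} = push₁-rewrite₃₃ pre (swap-naturalʳ (atom c) t T)

  slide-splitˡ : ∀ pre {a a' b' c} (t : Term (unit ⊗w atom a) (atom a' ⊗w atom b')) {T A} {r : Hom A (push pre (c ⊗₀ (a ⊗₀ T)))} →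
          (push₁ pre (id ⊗₁ sw {c} {b'} {T}) ∘ (push₁ pre (sw {c} {a'} {b' ⊗₀ T}) ∘ (push₁ pre (id ⊗₁ strict t T) ∘ r))) ≈
          (push₁ pre (strict t (c ⊗₀ T)) ∘ (push₁ pre (sw {c} {a} {T}) ∘ r))
  slide-splitˡ pre {c = c} t {T} = push₁-rewrite₃₂ pre (trans≈ (swap-naturalˡ (atom c) t T) (∘ʳ identityʳ))
  slide-splitʳ : ∀ pre {a a' b' c} (t : Term (unit ⊗w atom a) (atom a' ⊗w atom b')) {T A} {r : Hom A (push pre (a ⊗₀ (c ⊗₀ T)))} →
          (push₁ pre (sw {a'} {c} {b' ⊗₀ T}) ∘ (push₁ pre (id ⊗₁ sw {b'} {c} {T}) ∘ (push₁ pre (strict t (c ⊗₀ T)) ∘ r))) ≈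
          (push₁ pre (id ⊗₁ strict t T) ∘ (push₁ pre (sw {a} {c} {T}) ∘ r))
  slide-splitʳ pre {c = c} t {T} = push₁-rewrite₃₂ pre (trans≈ (swap-naturalʳ (atom c) t T) (∘ʳ identityˡ))

  applyChain : ∀ {A B D} → Chain B D → Hom A B → Hom A D
  applyChain [] r = r
  applyChain (h ∷ c) r = h ∘ applyChain c r

  applyChain-sound : ∀ {A B D} (c : Chain B D) (r : Hom A B) → applyChain c r ≈ (⟦ c ⟧c ∘ r)
  applyChain-sound [] r = sym≈ identityˡ
  applyChain-sound (h ∷ c) r = trans≈ (∘ʳ (applyChain-sound c r)) sym-assoc

  swapChain-cancel : ∀ pre u v T {A} {r : Hom A (push pre (push u (push v T)))} →
            applyChain (pushChain pre (swapChain v u T ++c swapChain u v T)) r ≈ r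
  swapChain-cancel pre u v T {r = r} = begin
    applyChain (pushChain pre (swapChain v u T ++c swapChain u v T)) r ≈⟨ applyChain-sound (pushChain pre (swapChain v u T ++c swapChain u v T)) r ⟩
    ⟦ pushChain pre (swapChain v u T ++c swapChain u v T) ⟧c ∘ r ≈⟨ ∘ˡ (pushChain-sound pre (swapChain v u T ++c swapChain u v T)) ⟩
    push₁ pre ⟦ swapChain v u T ++c swapChain u v T ⟧c ∘ r ≈⟨ ∘ˡ (push₁-resp pre (++c-sound (swapChain v u T) (swapChain u v T))) ⟩
    push₁ pre (⟦ swapChain v u T ⟧c ∘ ⟦ swapChain u v T ⟧c) ∘ r ≈⟨ ∘ˡ (push₁-resp pre (∘-resp-≈ (swapChain-sound v u T) (swapChain-sound u v T))) ⟩
    push₁ pre (swapBlock v u T ∘ swapBlock u v T) ∘ r ≈⟨ ∘ˡ (push₁-resp pre (swap-inverse u v T)) ⟩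
    push₁ pre id ∘ r ≈⟨ ∘ˡ (push₁-id pre) ⟩
    id ∘ r ≈⟨ identityˡ ⟩
    r ∎

  applyChain-push : ∀ pre {A B D} (c : Chain B D) (r : Hom A (push pre B)) → applyChain (pushChain pre c) r ≈ (push₁ pre ⟦ c ⟧c ∘ r)
  applyChain-push pre c r = trans≈ (applyChain-sound (pushChain pre c) r) (∘ˡ (pushChain-sound pre c))

  swapChain-naturalˡ : ∀ pre u {v v'} (t : Term v v') T {A} {r : Hom A (push pre (push u (push v T)))} →
         applyChain (pushChain pre (swapChain u v' T)) (push₁ pre (push₁ u (strict t T)) ∘ r) ≈ (push₁ pre (strict t (push u T)) ∘ applyChain (pushChain pre (swapChain u v T)) r)
  swapChain-naturalˡ pre u {v} {v'} t T {r = r} = begin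
    applyChain (pushChain pre (swapChain u v' T)) (push₁ pre (push₁ u (strict t T)) ∘ r) ≈⟨ applyChain-push pre (swapChain u v' T) _ ⟩
    push₁ pre ⟦ swapChain u v' T ⟧c ∘ (push₁ pre (push₁ u (strict t T)) ∘ r) ≈⟨ extendʳ (push₁-square pre (trans≈ (∘ˡ (swapChain-sound u v' T)) (trans≈ (swap-naturalˡ u t T) (∘ʳ (sym≈ (swapChain-sound u v T)))))) ⟩
    push₁ pre (strict t (push u T)) ∘ (push₁ pre ⟦ swapChain u v T ⟧c ∘ r) ≈˘⟨ ∘ʳ (applyChain-push pre (swapChain u v T) r) ⟩
    push₁ pre (strict t (push u T)) ∘ applyChain (pushChain pre (swapChain u v T)) r ∎

  swapChain-naturalʳ : ∀ pre v {u u'} (t : Term u u') T {A} {r : Hom A (push pre (push u (push v T)))} →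
         applyChain (pushChain pre (swapChain u' v T)) (push₁ pre (strict t (push v T)) ∘ r) ≈ (push₁ pre (push₁ v (strict t T)) ∘ applyChain (pushChain pre (swapChain u v T)) r)
  swapChain-naturalʳ pre v {u} {u'} t T {r = r} = begin
    applyChain (pushChain pre (swapChain u' v T)) (push₁ pre (strict t (push v T)) ∘ r) ≈⟨ applyChain-push pre (swapChain u' v T) _ ⟩
    push₁ pre ⟦ swapChain u' v T ⟧c ∘ (push₁ pre (strict t (push v T)) ∘ r) ≈⟨ extendʳ (push₁-square pre (trans≈ (∘ˡ (swapChain-sound u' v T)) (trans≈ (swap-naturalʳ v t T) (∘ʳ (sym≈ (swapChain-sound u v T)))))) ⟩
    push₁ pre (push₁ v (strict t T)) ∘ (push₁ pre ⟦ swapChain u v T ⟧c ∘ r) ≈˘⟨ ∘ʳ (applyChain-push pre (swapChain u v T) r) ⟩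
    push₁ pre (push₁ v (strict t T)) ∘ applyChain (pushChain pre (swapChain u v T)) r ∎

module CombCalculus {o ℓ e} (𝒞 : SMC o ℓ e) where
  open SMCReasoning 𝒞
  open Coherence 𝒞
  open Combs 𝒞

  private variable
    P P' Q Q' R R' X X2 Y Y2 Z A B M M2 N P2 P2' : Obj

  seqTerm : ∀ {p q m n x y z} → Term (p ⊗w x) (m ⊗w y) → Term (q ⊗w y) (n ⊗w z) →
             Term ((p ⊗w q) ⊗w x) ((m ⊗w n) ⊗w z)
  seqTerm a b = α⁻¹T ∘T (idT ⊗T b) ∘T (idT ⊗T σT) ∘T αT ∘T (a ⊗T idT) ∘T α⁻¹T ∘T (idT ⊗T σT) ∘T αT

  ιTerm : ∀ {a b c d} → Term ((a ⊗w b) ⊗w (c ⊗w d)) ((a ⊗w c) ⊗w (b ⊗w d))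
  ιTerm = α⁻¹T ∘T (idT ⊗T (αT ∘T (σT ⊗T idT) ∘T α⁻¹T)) ∘T αT

  parComp : ∀ {P M X Y P2 M2 X2 Y2 R} → Hom (P ⊗₀ X) (M ⊗₀ Y) → Hom (P2 ⊗₀ X2) (M2 ⊗₀ Y2) →
           Hom R (P ⊗₀ P2) → Hom (R ⊗₀ (X ⊗₀ X2)) ((M ⊗₀ M2) ⊗₀ (Y ⊗₀ Y2))
  parComp f f' p = ι ∘ ((f ⊗₁ f') ∘ (ι ∘ (p ⊗₁ id)))

  parTerm : ∀ {p m x y p2 m2 x2 y2 r} → Term (p ⊗w x) (m ⊗w y) → Term (p2 ⊗w x2) (m2 ⊗w y2) →
            Term r (p ⊗w p2) → Term (r ⊗w (x ⊗w x2)) ((m ⊗w m2) ⊗w (y ⊗w y2))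
  parTerm a b q = ιTerm ∘T ((a ⊗T b) ∘T (ιTerm ∘T (q ⊗T idT)))

  box : ∀ {A B D E} → Hom (A ⊗₀ B) (D ⊗₀ E) → Term (atom A ⊗w atom B) (atom D ⊗w atom E)
  box f = gen f

  box₀ : ∀ {B D E} → Hom (𝟙 ⊗₀ B) (D ⊗₀ E) → Term (unit ⊗w atom B) (atom D ⊗w atom E)
  box₀ f = gen f
  arr : ∀ {A B} → Hom A B → Term (atom A) (atom B)
  arr f = gen f
  split : ∀ {A B D} → Hom A (B ⊗₀ D) → Term (atom A) (atom B ⊗w atom D)
  split f = gen f

  -- Two tuples are conjugate when their components agree up to invertible
  -- memory morphisms m_i: g_i = (m_i ⊗ id) ∘ f_i ∘ (m_{i-1}⁻¹ ⊗ id).  All the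
  -- laws of Comb_∞ are proved in this form.
  Conjugate : ∀ {X Y P P'} k n → Hom P' P → Tuple X Y P k n → Tuple X Y P' k n → Set (ℓ ⊔ e)
  Conjugate k zero pinv (A , f) (B , g) = Σ (Hom A B) λ m → g ≈ ((m ⊗₁ id) ∘ (f ∘ (pinv ⊗₁ id)))
  Conjugate k (suc n) pinv (A , f , t) (B , g , u) =
    Σ (Hom A B) λ m → Σ (Hom B A) λ mi → ((mi ∘ m) ≈ id) ×
      ((g ≈ ((m ⊗₁ id) ∘ (f ∘ (pinv ⊗₁ id)))) × Conjugate (suc k) n mi t u)

  precompose-inverse : ∀ {A B D E} {f : Hom (A ⊗₀ E) D} {p : Hom A B} {pinv : Hom B A} →
               (pinv ∘ p) ≈ id → f ≈ ((f ∘ (pinv ⊗₁ id)) ∘ (p ⊗₁ id))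
  precompose-inverse {f = f} {p} {pinv} q = begin
    f ≈˘⟨ identityʳ ⟩
    f ∘ id ≈˘⟨ ∘ʳ ⊗-identity ⟩
    f ∘ (id ⊗₁ id) ≈˘⟨ ∘ʳ (⊗ˡ q) ⟩
    f ∘ ((pinv ∘ p) ⊗₁ id) ≈⟨ ∘ʳ ∘⊗id ⟩
    f ∘ ((pinv ⊗₁ id) ∘ (p ⊗₁ id)) ≈⟨ sym-assoc ⟩
    (f ∘ (pinv ⊗₁ id)) ∘ (p ⊗₁ id) ∎

  conjugate⇒step : ∀ {X Y P P'} k n {p : Hom P P'} {pinv : Hom P' P} → (pinv ∘ p) ≈ id →
              (t : Tuple X Y P k n) (u : Tuple X Y P' k n) → Conjugate k n pinv t u → Step k n p t u
  conjugate⇒step k zero q (A , f) (B , g) (m , eq) = m , (f ∘ (_ ⊗₁ id)) , precompose-inverse q , eq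
  conjugate⇒step k (suc n) q (A , f , t) (B , g , u) (m , mi , iso , eq , c) =
    m , (f ∘ (_ ⊗₁ id)) , precompose-inverse q , eq , conjugate⇒step (suc k) n iso t u c

  conjugate⇒CombEq : ∀ {X Y} n (t u : Rep X Y n) → Conjugate 0 n id t u → CombEq n t u
  conjugate⇒CombEq n t u c = EqC.return (conjugate⇒step 0 n identityˡ t u c)

  unitConj : ∀ {x y} → Term x y → Term (unit ⊗w x) (unit ⊗w y)
  unitConj h = λ⁻¹T ∘T h ∘T λT


  seq-inputˡ : (h : Hom (P' ⊗₀ X) (A ⊗₀ Y)) (p : Hom P P') (g : Hom (Q ⊗₀ Y) (N ⊗₀ Z)) (q : Hom R (P ⊗₀ Q)) →
       (seqComp (h ∘ (p ⊗₁ id)) g ∘ (q ⊗₁ id)) ≈ (seqComp h g ∘ (((p ⊗₁ id) ∘ q) ⊗₁ id))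
  seq-inputˡ h p g q = coherence-chain (seqTerm (box h ∘T (arr p ⊗T idT)) (box g) ∘T (split q ⊗T idT))
                    (seqTerm (box h) (box g) ∘T (((arr p ⊗T idT) ∘T split q) ⊗T idT))
                    (∘ʳ (∘ʳ (∘ʳ (extendʳ (strict-natural (arr p) sw)))))

  seq-outputˡ : (h : Hom (P ⊗₀ X) (A ⊗₀ Y)) (m : Hom A B) (g : Hom (Q ⊗₀ Y) (M ⊗₀ Z)) (q : Hom R (P ⊗₀ Q)) →
       (seqComp ((m ⊗₁ id) ∘ h) g ∘ (q ⊗₁ id)) ≈ (((m ⊗₁ id) ⊗₁ id) ∘ (seqComp h g ∘ (q ⊗₁ id)))
  seq-outputˡ h m g q = coherence-chain (seqTerm ((arr m ⊗T idT) ∘T box h) (box g) ∘T (split q ⊗T idT))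
                    (((arr m ⊗T idT) ⊗T idT) ∘T (seqTerm (box h) (box g) ∘T (split q ⊗T idT)))
                    (trans≈ (∘ʳ (sym≈ (extendʳ (strict-natural (arr m) _)))) (sym≈ (extendʳ (strict-natural (arr m) _))))
  seq-inputʳ : (f : Hom (P ⊗₀ X) (M ⊗₀ Y)) (h : Hom (Q' ⊗₀ Y) (A ⊗₀ Z)) (p : Hom Q Q') (q : Hom R (P ⊗₀ Q)) →
       (seqComp f (h ∘ (p ⊗₁ id)) ∘ (q ⊗₁ id)) ≈ (seqComp f h ∘ (((id ⊗₁ p) ∘ q) ⊗₁ id))
  seq-inputʳ {X = X} {Y = Y} f h p q = coherence-chain (seqTerm (box f) (box h ∘T (arr p ⊗T idT)) ∘T (split q ⊗T idT))
                    (seqTerm (box f) (box h) ∘T (((idT ⊗T arr p) ∘T split q) ⊗T idT))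
                    (∘ʳ (trans≈ (extendʳ (push₁-square (atom _) (sym≈ (swap-naturalˡ (atom Y) (arr p) _))))
                        (∘ʳ (trans≈ (sym≈ (extendʳ (strict-natural (box f) _)))
                            (∘ʳ (extendʳ (push₁-square (atom _) (sym≈ (swap-naturalʳ (atom X) (arr p) _)))))))))
  seq-outputʳ : (f : Hom (P ⊗₀ X) (M ⊗₀ Y)) (h : Hom (Q ⊗₀ Y) (A ⊗₀ Z)) (m : Hom A B) (q : Hom R (P ⊗₀ Q)) →
       (seqComp f ((m ⊗₁ id) ∘ h) ∘ (q ⊗₁ id)) ≈ (((id ⊗₁ m) ⊗₁ id) ∘ (seqComp f h ∘ (q ⊗₁ id)))
  seq-outputʳ f h m q = coherence-chain (seqTerm (box f) ((arr m ⊗T idT) ∘T box h) ∘T (split q ⊗T idT))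
                    (((idT ⊗T arr m) ⊗T idT) ∘T (seqTerm (box f) (box h) ∘T (split q ⊗T idT))) refl≈

  par-inputˡ : (h : Hom (P' ⊗₀ X) (A ⊗₀ Y)) (p : Hom P P') (f' : Hom (P2 ⊗₀ X2) (M2 ⊗₀ Y2)) (q : Hom R (P ⊗₀ P2)) →
        parComp (h ∘ (p ⊗₁ id)) f' q ≈ parComp h f' ((p ⊗₁ id) ∘ q)
  par-inputˡ h p f' q = coherence-chain (parTerm (box h ∘T (arr p ⊗T idT)) (box f') (split q))
                      (parTerm (box h) (box f') ((arr p ⊗T idT) ∘T split q))
                      (∘ʳ (∘ʳ (trans≈ (extendʳ (strict-natural (arr p) _)) (∘ʳ (extendʳ (strict-natural (arr p) _))))))
  par-outputˡ : (h : Hom (P ⊗₀ X) (A ⊗₀ Y)) (m : Hom A B) (f' : Hom (P2 ⊗₀ X2) (M2 ⊗₀ Y2)) (q : Hom R (P ⊗₀ P2)) →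
        parComp ((m ⊗₁ id) ∘ h) f' q ≈ (((m ⊗₁ id) ⊗₁ id) ∘ parComp h f' q)
  par-outputˡ h m f' q = coherence-chain (parTerm ((arr m ⊗T idT) ∘T box h) (box f') (split q))
                      (((arr m ⊗T idT) ⊗T idT) ∘T parTerm (box h) (box f') (split q))
                      (sym≈ (extendʳ (strict-natural (arr m) _)))
  par-inputʳ : (f : Hom (P ⊗₀ X) (M ⊗₀ Y)) (h : Hom (P2' ⊗₀ X2) (A ⊗₀ Y2)) (p : Hom P2 P2') (q : Hom R (P ⊗₀ P2)) →
        parComp f (h ∘ (p ⊗₁ id)) q ≈ parComp f h ((id ⊗₁ p) ∘ q)
  par-inputʳ {X = X} f h p q = coherence-chain (parTerm (box f) (box h ∘T (arr p ⊗T idT)) (split q))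
                     (parTerm (box f) (box h) ((idT ⊗T arr p) ∘T split q))
                     (∘ʳ (∘ʳ (∘ʳ (extendʳ (push₁-square (atom _) (sym≈ (swap-naturalʳ (atom X) (arr p) _)))))))
  par-outputʳ : (f : Hom (P ⊗₀ X) (M ⊗₀ Y)) (h : Hom (P2 ⊗₀ X2) (A ⊗₀ Y2)) (m : Hom A B) (q : Hom R (P ⊗₀ P2)) →
        parComp f ((m ⊗₁ id) ∘ h) q ≈ (((id ⊗₁ m) ⊗₁ id) ∘ parComp f h q)
  par-outputʳ {Y = Y} f h m q = coherence-chain (parTerm (box f) ((arr m ⊗T idT) ∘T box h) (split q))
                     (((idT ⊗T arr m) ⊗T idT) ∘T parTerm (box f) (box h) (split q))
                     (trans≈ (∘ʳ (extendʳ (strict-natural (box f) _))) (extendʳ (push₁-square (atom _) (swap-naturalˡ (atom Y) (arr m) _))))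

  seq-precompose : (h : Hom (P ⊗₀ X) (M ⊗₀ Y)) (g : Hom (Q ⊗₀ Y) (N ⊗₀ Z)) (q : Hom R' (P ⊗₀ Q)) (r : Hom R R') →
             (seqComp h g ∘ ((q ∘ r) ⊗₁ id)) ≈ ((seqComp h g ∘ (q ⊗₁ id)) ∘ (r ⊗₁ id))
  seq-precompose h g q r = coherence-chain (seqTerm (box h) (box g) ∘T ((split q ∘T arr r) ⊗T idT))
                          ((seqTerm (box h) (box g) ∘T (split q ⊗T idT)) ∘T (arr r ⊗T idT)) refl≈
  par-precompose : (h : Hom (P ⊗₀ X) (M ⊗₀ Y)) (g : Hom (P2 ⊗₀ X2) (M2 ⊗₀ Y2)) (q : Hom R' (P ⊗₀ P2)) (r : Hom R R') →
             parComp h g (q ∘ r) ≈ (parComp h g q ∘ (r ⊗₁ id))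
  par-precompose h g q r = coherence-chain (parTerm (box h) (box g) (split q ∘T arr r))
                          (parTerm (box h) (box g) (split q) ∘T (arr r ⊗T idT)) refl≈

  seqComp-congˡ : ∀ {P Q M N X Y Z} {f f' : Hom (P ⊗₀ X) (M ⊗₀ Y)} {g : Hom (Q ⊗₀ Y) (N ⊗₀ Z)} →
              f ≈ f' → seqComp f g ≈ seqComp f' g
  seqComp-congˡ p = ∘ʳ (∘ʳ (∘ʳ (∘ʳ (∘ˡ (⊗ˡ p)))))
  seqComp-congʳ : ∀ {P Q M N X Y Z} {f : Hom (P ⊗₀ X) (M ⊗₀ Y)} {g g' : Hom (Q ⊗₀ Y) (N ⊗₀ Z)} →
              g ≈ g' → seqComp f g ≈ seqComp f g'
  seqComp-congʳ p = ∘ʳ (∘ˡ (⊗ʳ p))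
  parComp-congˡ : ∀ {P M X Y P2 M2 X2 Y2 R} {f f' : Hom (P ⊗₀ X) (M ⊗₀ Y)} {g : Hom (P2 ⊗₀ X2) (M2 ⊗₀ Y2)} {q : Hom R (P ⊗₀ P2)} →
              f ≈ f' → parComp f g q ≈ parComp f' g q
  parComp-congˡ p = ∘ʳ (∘ˡ (⊗ˡ p))
  parComp-congʳ : ∀ {P M X Y P2 M2 X2 Y2 R} {f : Hom (P ⊗₀ X) (M ⊗₀ Y)} {g g' : Hom (P2 ⊗₀ X2) (M2 ⊗₀ Y2)} {q : Hom R (P ⊗₀ P2)} →
              g ≈ g' → parComp f g q ≈ parComp f g' q
  parComp-congʳ p = ∘ʳ (∘ˡ (⊗ʳ p))

  -- The memory morphism of the next stage, as required by the step lemmas.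
  id-commutes : ∀ {A B} {m : Hom A B} → (id ∘ m) ≈ (m ∘ id)
  id-commutes = trans≈ identityˡ (sym≈ identityʳ)

  seqT-stepˡ : ∀ {X Y Z : Fam} k n {P P' Q R R'} (p : Hom P P') (q : Hom R (P ⊗₀ Q)) (q' : Hom R' (P' ⊗₀ Q)) (r : Hom R R') →
             (q' ∘ r) ≈ ((p ⊗₁ id) ∘ q) → (t : Tuple X Y P k n) (t' : Tuple X Y P' k n) (u : Tuple Y Z Q k n) →
             Step k n p t t' → Step k n r (seqT k n q t u) (seqT k n q' t' u)
  seqT-stepˡ k zero p q q' r c (A , f) (B , g) (N , g2) (m , h , ef , eg) =
    (m ⊗₁ id) , (seqComp h g2 ∘ (q' ⊗₁ id)) ,
    trans≈ (∘ˡ (seqComp-congˡ ef)) (trans≈ (seq-inputˡ h p g2 q) (trans≈ (∘ʳ (⊗ˡ (sym≈ c))) (seq-precompose h g2 q' r))) ,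
    trans≈ (∘ˡ (seqComp-congˡ eg)) (seq-outputˡ h m g2 q')
  seqT-stepˡ {X} {Y} {Z} k (suc n) p q q' r c (A , f , t) (B , g , t') (N , g2 , u) (m , h , ef , eg , st) =
    let (m′ , h′ , e₁ , e₂) = seqT-stepˡ {X} {Y} {Z} k zero p q q' r c (A , f) (B , g) (N , g2) (m , h , ef , eg)
    in  m′ , h′ , e₁ , e₂ , seqT-stepˡ (suc k) n m id id (m ⊗₁ id) id-commutes t t' u st

  seqT-stepʳ : ∀ {X Y Z : Fam} k n {P Q Q' R R'} (p : Hom Q Q') (q : Hom R (P ⊗₀ Q)) (q' : Hom R' (P ⊗₀ Q')) (r : Hom R R') →
             (q' ∘ r) ≈ ((id ⊗₁ p) ∘ q) → (t : Tuple X Y P k n) (u : Tuple Y Z Q k n) (u' : Tuple Y Z Q' k n) →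
             Step k n p u u' → Step k n r (seqT k n q t u) (seqT k n q' t u')
  seqT-stepʳ k zero p q q' r c (M , f) (A , g) (B , g') (m , h , eu , eu') =
    (id ⊗₁ m) , (seqComp f h ∘ (q' ⊗₁ id)) ,
    trans≈ (∘ˡ (seqComp-congʳ eu)) (trans≈ (seq-inputʳ f h p q) (trans≈ (∘ʳ (⊗ˡ (sym≈ c))) (seq-precompose f h q' r))) ,
    trans≈ (∘ˡ (seqComp-congʳ eu')) (seq-outputʳ f h m q')
  seqT-stepʳ {X} {Y} {Z} k (suc n) p q q' r c (M , f , t) (A , g , u) (B , g' , u') (m , h , eu , eu' , st) =
    let (m′ , h′ , e₁ , e₂) = seqT-stepʳ {X} {Y} {Z} k zero p q q' r c (M , f) (A , g) (B , g') (m , h , eu , eu')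
    in  m′ , h′ , e₁ , e₂ , seqT-stepʳ (suc k) n m id id (id ⊗₁ m) id-commutes t u u' st

  parT-stepˡ : ∀ {X Y X' Y' : Fam} k n {P P' Q R R'} (p : Hom P P') (q : Hom R (P ⊗₀ Q)) (q' : Hom R' (P' ⊗₀ Q)) (r : Hom R R') →
             (q' ∘ r) ≈ ((p ⊗₁ id) ∘ q) → (t : Tuple X Y P k n) (t' : Tuple X Y P' k n) (u : Tuple X' Y' Q k n) →
             Step k n p t t' → Step k n r (parT k n q t u) (parT k n q' t' u)
  parT-stepˡ k zero p q q' r c (A , f) (B , g) (N , g2) (m , h , ef , eg) =
    (m ⊗₁ id) , parComp h g2 q' ,
    trans≈ (parComp-congˡ ef) (trans≈ (par-inputˡ h p g2 q) (trans≈ (∘ʳ (∘ʳ (∘ʳ (⊗ˡ (sym≈ c))))) (par-precompose h g2 q' r))) ,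
    trans≈ (parComp-congˡ eg) (par-outputˡ h m g2 q')
  parT-stepˡ {X} {Y} {X'} {Y'} k (suc n) p q q' r c (A , f , t) (B , g , t') (N , g2 , u) (m , h , ef , eg , st) =
    let (m′ , h′ , e₁ , e₂) = parT-stepˡ {X} {Y} {X'} {Y'} k zero p q q' r c (A , f) (B , g) (N , g2) (m , h , ef , eg)
    in  m′ , h′ , e₁ , e₂ , parT-stepˡ (suc k) n m id id (m ⊗₁ id) id-commutes t t' u st

  parT-stepʳ : ∀ {X Y X' Y' : Fam} k n {P Q Q' R R'} (p : Hom Q Q') (q : Hom R (P ⊗₀ Q)) (q' : Hom R' (P ⊗₀ Q')) (r : Hom R R') →
             (q' ∘ r) ≈ ((id ⊗₁ p) ∘ q) → (t : Tuple X Y P k n) (u : Tuple X' Y' Q k n) (u' : Tuple X' Y' Q' k n) →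
             Step k n p u u' → Step k n r (parT k n q t u) (parT k n q' t u')
  parT-stepʳ k zero p q q' r c (M , f) (A , g) (B , g') (m , h , eu , eu') =
    (id ⊗₁ m) , parComp f h q' ,
    trans≈ (parComp-congʳ eu) (trans≈ (par-inputʳ f h p q) (trans≈ (∘ʳ (∘ʳ (∘ʳ (⊗ˡ (sym≈ c))))) (par-precompose f h q' r))) ,
    trans≈ (parComp-congʳ eu') (par-outputʳ f h m q')
  parT-stepʳ {X} {Y} {X'} {Y'} k (suc n) p q q' r c (M , f , t) (A , g , u) (B , g' , u') (m , h , eu , eu' , st) =
    let (m′ , h′ , e₁ , e₂) = parT-stepʳ {X} {Y} {X'} {Y'} k zero p q q' r c (M , f) (A , g) (B , g') (m , h , eu , eu')
    in  m′ , h′ , e₁ , e₂ , parT-stepʳ (suc k) n m id id (id ⊗₁ m) id-commutes t u u' st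

  module CombEq-Equiv {X Y : Fam} {n : ℕ} = IsEquivalence (EqC.isEquivalence (Step {X} {Y} {𝟙} {𝟙} 0 n id))

  unitorˡ⁻¹-square : (unitorˡ⁻¹ ∘ id) ≈ ((id ⊗₁ id) ∘ unitorˡ⁻¹ {𝟙})
  unitorˡ⁻¹-square = trans≈ identityʳ (sym≈ (trans≈ (∘ˡ ⊗-identity) identityˡ))

  seq-congˡ : ∀ {X Y Z : Fam} n {t t' : Rep X Y n} (u : Rep Y Z n) → CombEq n t t' →
             CombEq n (seqT 0 n unitorˡ⁻¹ t u) (seqT 0 n unitorˡ⁻¹ t' u)
  seq-congˡ n u = EqC.gmap (λ x → seqT 0 n unitorˡ⁻¹ x u)
                   (λ {x} {y} st → seqT-stepˡ 0 n id unitorˡ⁻¹ unitorˡ⁻¹ id unitorˡ⁻¹-square x y u st)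
  seq-congʳ : ∀ {X Y Z : Fam} n (t : Rep X Y n) {u u' : Rep Y Z n} → CombEq n u u' →
             CombEq n (seqT 0 n unitorˡ⁻¹ t u) (seqT 0 n unitorˡ⁻¹ t u')
  seq-congʳ n t = EqC.gmap (λ x → seqT 0 n unitorˡ⁻¹ t x)
                   (λ {x} {y} st → seqT-stepʳ 0 n id unitorˡ⁻¹ unitorˡ⁻¹ id unitorˡ⁻¹-square t x y st)
  par-congˡ : ∀ {X Y X' Y' : Fam} n {t t' : Rep X Y n} (u : Rep X' Y' n) → CombEq n t t' →
             CombEq n (parT 0 n unitorˡ⁻¹ t u) (parT 0 n unitorˡ⁻¹ t' u)
  par-congˡ n u = EqC.gmap (λ x → parT 0 n unitorˡ⁻¹ x u)
                   (λ {x} {y} st → parT-stepˡ 0 n id unitorˡ⁻¹ unitorˡ⁻¹ id unitorˡ⁻¹-square x y u st)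
  par-congʳ : ∀ {X Y X' Y' : Fam} n (t : Rep X Y n) {u u' : Rep X' Y' n} → CombEq n u u' →
             CombEq n (parT 0 n unitorˡ⁻¹ t u) (parT 0 n unitorˡ⁻¹ t u')
  par-congʳ n t = EqC.gmap (λ x → parT 0 n unitorˡ⁻¹ t x)
                   (λ {x} {y} st → parT-stepʳ 0 n id unitorˡ⁻¹ unitorˡ⁻¹ id unitorˡ⁻¹-square t x y st)

  proj-seqT : ∀ {X Y Z : Fam} k n {P Q R} (q : Hom R (P ⊗₀ Q)) (t : Tuple X Y P k (suc n)) (u : Tuple Y Z Q k (suc n)) →
              proj k n (seqT k (suc n) q t u) ≡ seqT k n q (proj k n t) (proj k n u)
  proj-seqT k zero q (M , f , t) (N , g , u) = PE.refl
  proj-seqT k (suc n) q (M , f , t) (N , g , u) = PE.cong (λ x → (M ⊗₀ N) , (seqComp f g ∘ (q ⊗₁ id)) , x) (proj-seqT (suc k) n id t u)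

  proj-parT : ∀ {X Y X' Y' : Fam} k n {P Q R} (q : Hom R (P ⊗₀ Q)) (t : Tuple X Y P k (suc n)) (u : Tuple X' Y' Q k (suc n)) →
              proj k n (parT k (suc n) q t u) ≡ parT k n q (proj k n t) (proj k n u)
  proj-parT k zero q (M , f , t) (N , g , u) = PE.refl
  proj-parT k (suc n) q (M , f , t) (N , g , u) = PE.cong (λ x → (M ⊗₀ N) , parComp f g q , x) (proj-parT (suc k) n id t u)

  infixr 9 _∘ᶜ_
  infixr 10 _⊗ᶜ_
  _∘ᶜ_ : ∀ {X Y Z} → Comb∞ Y Z → Comb∞ X Y → Comb∞ X Z
  stage (g ∘ᶜ f) = seqStage g f
  compat (g ∘ᶜ f) n =
    PE.subst (λ x → CombEq n x (seqStage g f n)) (PE.sym (proj-seqT 0 n unitorˡ⁻¹ (stage f (suc n)) (stage g (suc n))))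
      (CombEq-Equiv.trans (seq-congˡ n _ (compat f n)) (seq-congʳ n (stage f n) (compat g n)))

  _⊗ᶜ_ : ∀ {X Y X' Y'} → Comb∞ X Y → Comb∞ X' Y' → Comb∞ (X ⊗ᶠ X') (Y ⊗ᶠ Y')
  stage (f ⊗ᶜ f') = parStage f f'
  compat (f ⊗ᶜ f') n =
    PE.subst (λ x → CombEq n x (parStage f f' n)) (PE.sym (proj-parT 0 n unitorˡ⁻¹ (stage f (suc n)) (stage f' (suc n))))
      (CombEq-Equiv.trans (par-congˡ n _ (compat f n)) (par-congʳ n (stage f n) (compat f' n)))

-- In every module, `stagesFrom k n` treats the stages
-- after the first (incoming memory morphism id), and `stages n` the whole
-- representative (incoming memory split 𝟙 → 𝟙 ⊗ 𝟙).  A single stage is a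
-- component equation, an instance of coherence; a longer representative
-- reuses it and adds an inverse of the memory morphism.
module CombLaws {o ℓ e} (𝒞 : SMC o ℓ e) where
  open SMCReasoning 𝒞
  open Coherence 𝒞
  open Combs 𝒞
  open CombCalculus 𝒞

  -- id ∘ᶜ f = f: the memories M_i ⊗ 𝟙 are identified with M_i by ρ.
  module LeftIdentity {X Y : Fam} where
    stagesFrom : ∀ k n {P} (t : Tuple X Y P k n) → Conjugate k n unitorʳ⁻¹ (seqT k n id t (iT k n (λ _ → id))) t
    stagesFrom k zero (M , f) = unitorʳ ,
      coherence-chain (box f) ((ρT ⊗T idT) ∘T ((seqTerm (box f) (unitConj idT) ∘T (idT ⊗T idT)) ∘T (ρ⁻¹T ⊗T idT))) refl≈
    stagesFrom k (suc n) (M , f , t) =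
      let (m , eq) = stagesFrom k zero (M , f)
      in  m , unitorʳ⁻¹ , unitorʳ-isoˡ , eq , stagesFrom (suc k) n t
    stages : ∀ n (t : Rep X Y n) → Conjugate 0 n id (seqT 0 n unitorˡ⁻¹ t (iT 0 n (λ _ → id))) t
    stages zero (M , f) = unitorʳ ,
      coherence-chain (box₀ f) ((ρT ⊗T idT) ∘T ((seqTerm (box₀ f) (unitConj idT) ∘T (λ⁻¹T ⊗T idT)) ∘T (idT ⊗T idT))) refl≈
    stages (suc n) (M , f , t) =
      let (m , eq) = stages zero (M , f)
      in  m , unitorʳ⁻¹ , unitorʳ-isoˡ , eq , stagesFrom 1 n t

  -- f ∘ᶜ id = f: the memories 𝟙 ⊗ M_i are identified with M_i by λ.
  module RightIdentity {X Y : Fam} where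
    stagesFrom : ∀ k n {P} (t : Tuple X Y P k n) → Conjugate k n unitorˡ⁻¹ (seqT k n id (iT k n (λ _ → id)) t) t
    stagesFrom k zero (M , f) = unitorˡ ,
      coherence-chain (box f) ((λT ⊗T idT) ∘T ((seqTerm (unitConj idT) (box f) ∘T (idT ⊗T idT)) ∘T (λ⁻¹T ⊗T idT)))
        (∘ʳ (sym≈ (cancel-sw unit)))
    stagesFrom k (suc n) (M , f , t) =
      let (m , eq) = stagesFrom k zero (M , f)
      in  m , unitorˡ⁻¹ , unitorˡ-isoˡ , eq , stagesFrom (suc k) n t
    stages : ∀ n (t : Rep X Y n) → Conjugate 0 n id (seqT 0 n unitorˡ⁻¹ (iT 0 n (λ _ → id)) t) t
    stages zero (M , f) = unitorˡ ,
      coherence-chain (box₀ f) ((λT ⊗T idT) ∘T ((seqTerm (unitConj idT) (box₀ f) ∘T (λ⁻¹T ⊗T idT)) ∘T (idT ⊗T idT))) refl≈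
    stages (suc n) (M , f , t) =
      let (m , eq) = stages zero (M , f)
      in  m , unitorˡ⁻¹ , unitorˡ-isoˡ , eq , stagesFrom 1 n t

  -- Associativity of ∘ᶜ: the memories are reassociated by α.
  module Associativity {X Y Z W : Fam} where
    stagesFrom : ∀ k n {P Q R} (t : Tuple X Y P k n) (u : Tuple Y Z Q k n) (v : Tuple Z W R k n) →
                 Conjugate k n α (seqT k n id t (seqT k n id u v)) (seqT k n id (seqT k n id t u) v)
    stagesFrom k zero (M , f) (N , g) (O , h) = α⁻¹ ,
      coherence-chain (seqTerm (seqTerm (box f) (box g) ∘T (idT ⊗T idT)) (box h) ∘T (idT ⊗T idT))
        ((α⁻¹T ⊗T idT) ∘T ((seqTerm (box f) (seqTerm (box g) (box h) ∘T (idT ⊗T idT)) ∘T (idT ⊗T idT)) ∘T (αT ⊗T idT)))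
        (sym≈ (∘ʳ (∘ʳ (∘ʳ (cancelInv (id⊗-inverse (id⊗-inverse (swap-inverse (atom _) (atom _) _))))))))
    stagesFrom k (suc n) (M , f , t) (N , g , u) (O , h , v) =
      let (m , eq) = stagesFrom k zero (M , f) (N , g) (O , h)
      in  m , α , α-isoʳ , eq , stagesFrom (suc k) n t u v
    stages : ∀ n (t : Rep X Y n) (u : Rep Y Z n) (v : Rep Z W n) →
             Conjugate 0 n id (seqT 0 n unitorˡ⁻¹ t (seqT 0 n unitorˡ⁻¹ u v)) (seqT 0 n unitorˡ⁻¹ (seqT 0 n unitorˡ⁻¹ t u) v)
    stages zero (M , f) (N , g) (O , h) = α⁻¹ ,
      coherence-chain (seqTerm (seqTerm (box₀ f) (box₀ g) ∘T (λ⁻¹T ⊗T idT)) (box₀ h) ∘T (λ⁻¹T ⊗T idT))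
        ((α⁻¹T ⊗T idT) ∘T ((seqTerm (box₀ f) (seqTerm (box₀ g) (box₀ h) ∘T (λ⁻¹T ⊗T idT)) ∘T (λ⁻¹T ⊗T idT)) ∘T (idT ⊗T idT)))
        refl≈
    stages (suc n) (M , f , t) (N , g , u) (O , h , v) =
      let (m , eq) = stages zero (M , f) (N , g) (O , h)
      in  m , α , α-isoʳ , eq , stagesFrom 1 n t u v

  ι-involutive : ∀ {A B D E} → (ι {A} {D} {B} {E} ∘ ι {A} {B} {D} {E}) ≈ id
  ι-involutive {A} {B} {D} {E} = coherence-chain (ιTerm {atom A} {atom D} {atom B} {atom E} ∘T ιTerm) idT (cancel-sw (atom _))

  -- The interchange law (g ∘ᶜ f) ⊗ᶜ (k ∘ᶜ h) = (g ⊗ᶜ k) ∘ᶜ (f ⊗ᶜ h): the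
  -- memories are permuted by ι.  The component equation is the one genuinely
  -- combinatorial instance of coherence: both chains are brought to the
  -- same order of boxes by sliding each box across the swaps separating it
  -- from its place (commute, slide-pair) and by braid moves between swaps.
  module Interchange {X Y Z X' Y' Z' : Fam} where
    component : ∀ {P Q P' Q' M N M' N'} j (f : Hom (P ⊗₀ X j) (M ⊗₀ Y j)) (g : Hom (Q ⊗₀ Y j) (N ⊗₀ Z j))
                (h : Hom (P' ⊗₀ X' j) (M' ⊗₀ Y' j)) (k : Hom (Q' ⊗₀ Y' j) (N' ⊗₀ Z' j)) →
                (seqComp (parComp f h id) (parComp g k id) ∘ (id ⊗₁ id)) ≈
                ((ι ⊗₁ id) ∘ (parComp (seqComp f g ∘ (id ⊗₁ id)) (seqComp h k ∘ (id ⊗₁ id)) id ∘ (ι ⊗₁ id)))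
    component j f g h k =
      coherence-chain (seqTerm (parTerm (box f) (box h) idT) (parTerm (box g) (box k) idT) ∘T (idT ⊗T idT))
        ((ιTerm ⊗T idT) ∘T (parTerm (seqTerm (box f) (box g) ∘T (idT ⊗T idT)) (seqTerm (box h) (box k) ∘T (idT ⊗T idT)) idT ∘T (ιTerm ⊗T idT)))
        (trans≈ (∘ʳ (∘ʳ (∘ʳ (cancel-sw (atom _ ⊗w atom _ ⊗w atom _)))))
        (trans≈ (∘ʳ (∘ʳ (∘ʳ (∘ʳ (∘ʳ (sym≈ (commute (atom _) (σT {atom _} {atom _}) _)))))))
        (trans≈ (∘ʳ (∘ʳ (∘ʳ (∘ʳ (sym≈ (commute (atom _) (σT {atom _} {atom _}) _))))))
        (trans≈ (∘ʳ (∘ʳ (∘ʳ (∘ʳ (∘ʳ (∘ʳ (sym≈ (commute unit (box f) _))))))))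
        (trans≈ (∘ʳ (∘ʳ (∘ʳ (∘ʳ (∘ʳ (sym≈ (commute unit (box f) _)))))))
        (trans≈ (∘ʳ (∘ʳ (∘ʳ (∘ʳ (∘ʳ (∘ʳ (∘ʳ (∘ʳ (∘ʳ (commute (atom _) (σT {atom _} {atom _}) _))))))))))
        (trans≈ (∘ʳ (∘ʳ (∘ʳ (∘ʳ (∘ʳ (∘ʳ (sym≈ (cancel-sw (atom _ ⊗w atom _)))))))))
        (trans≈ (∘ʳ (∘ʳ (∘ʳ (∘ʳ (∘ʳ (∘ʳ (∘ʳ (commute (atom _ ⊗w atom _) (σT {atom _} {atom _}) _))))))))
        (trans≈ (∘ʳ (∘ʳ (∘ʳ (∘ʳ (∘ʳ (∘ʳ (∘ʳ (∘ʳ (slide-pair (atom _ ⊗w atom _) (box h))))))))))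
        (trans≈ (∘ʳ (∘ʳ (∘ʳ (∘ʳ (∘ʳ (∘ʳ (∘ʳ (∘ʳ (∘ʳ (∘ʳ (cancel-sw (atom _ ⊗w atom _ ⊗w atom _))))))))))))
        (trans≈ (∘ʳ (∘ʳ (∘ʳ (∘ʳ (∘ʳ (∘ʳ (∘ʳ (∘ʳ (∘ʳ (sym≈ (yang-baxter-pushed (atom _))))))))))))
        (trans≈ (∘ʳ (∘ʳ (∘ʳ (∘ʳ (∘ʳ (∘ʳ (∘ʳ (∘ʳ (sym≈ (commute (atom _) (σT {atom _} {atom _}) _))))))))))
        (trans≈ (∘ʳ (∘ʳ (∘ʳ (∘ʳ (∘ʳ (∘ʳ (∘ʳ (∘ʳ (∘ʳ (∘ʳ (∘ʳ (commute (atom _) (σT {atom _} {atom _}) _))))))))))))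
        (trans≈ (∘ʳ (∘ʳ (∘ʳ (∘ʳ (∘ʳ (∘ʳ (∘ʳ (∘ʳ (∘ʳ (∘ʳ (commute (atom _ ⊗w atom _) (σT {atom _} {atom _}) _)))))))))))
        (trans≈ (∘ʳ (∘ʳ (∘ʳ (∘ʳ (∘ʳ (∘ʳ (∘ʳ (∘ʳ (∘ʳ (∘ʳ (∘ʳ (∘ʳ (commute (atom _) (σT {atom _} {atom _}) _)))))))))))))
        (trans≈ (sym≈ (∘ʳ (∘ʳ (∘ʳ (∘ʳ (∘ʳ (∘ʳ (∘ʳ (commute (atom _) (σT {atom _} {atom _}) _)))))))))
        (trans≈ (sym≈ (∘ʳ (∘ʳ (commute (atom _ ⊗w atom _) (σT {atom _} {atom _}) _))))
        (trans≈ (sym≈ (∘ʳ (∘ʳ (∘ʳ (commute (atom _) (σT {atom _} {atom _}) _)))))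
        (trans≈ (sym≈ (∘ʳ (∘ʳ (∘ʳ (∘ʳ (commute unit (box f) _))))))
        (trans≈ (sym≈ (∘ʳ (∘ʳ (∘ʳ (∘ʳ (∘ʳ (commute (atom _ ⊗w atom _) (σT {atom _} {atom _}) _)))))))
        (trans≈ (sym≈ (∘ʳ (∘ʳ (∘ʳ (∘ʳ (∘ʳ (∘ʳ (commute (atom _) (σT {atom _} {atom _}) _))))))))
        (trans≈ (sym≈ (∘ʳ (∘ʳ (∘ʳ (∘ʳ (sym≈ (commute unit (box f) _)))))))
        (trans≈ (sym≈ (∘ʳ (∘ʳ (yang-baxter-pushed (atom _)))))
        (trans≈ (sym≈ (∘ʳ (slide-pair (atom _) (box g))))
        (sym≈ (commute (atom _) (σT {atom _} {atom _}) _))))))))))))))))))))))))))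
    stagesFrom : ∀ j n {P Q P' Q'} (t : Tuple X Y P j n) (u : Tuple Y Z Q j n) (v : Tuple X' Y' P' j n) (w : Tuple Y' Z' Q' j n) →
                 Conjugate j n ι (parT j n id (seqT j n id t u) (seqT j n id v w)) (seqT j n id (parT j n id t v) (parT j n id u w))
    stagesFrom j zero (M , f) (N , g) (M' , h) (N' , k) = ι , component j f g h k
    stagesFrom j (suc n) (M , f , t) (N , g , u) (M' , h , v) (N' , k , w) =
      let (m , eq) = stagesFrom j zero (M , f) (N , g) (M' , h) (N' , k)
      in  m , ι , ι-involutive , eq , stagesFrom (suc j) n t u v w
    stages : ∀ n (t : Rep X Y n) (u : Rep Y Z n) (v : Rep X' Y' n) (w : Rep Y' Z' n) →
             Conjugate 0 n id (parT 0 n unitorˡ⁻¹ (seqT 0 n unitorˡ⁻¹ t u) (seqT 0 n unitorˡ⁻¹ v w))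
                              (seqT 0 n unitorˡ⁻¹ (parT 0 n unitorˡ⁻¹ t v) (parT 0 n unitorˡ⁻¹ u w))
    stages zero (M , f) (N , g) (M' , h) (N' , k) = ι ,
      coherence-chain (seqTerm (parTerm (box₀ f) (box₀ h) λ⁻¹T) (parTerm (box₀ g) (box₀ k) λ⁻¹T) ∘T (λ⁻¹T ⊗T idT))
        ((ιTerm ⊗T idT) ∘T (parTerm (seqTerm (box₀ f) (box₀ g) ∘T (λ⁻¹T ⊗T idT)) (seqTerm (box₀ h) (box₀ k) ∘T (λ⁻¹T ⊗T idT)) λ⁻¹T ∘T (idT ⊗T idT)))
        (trans≈ (∘ʳ (∘ʳ (sym≈ (commute (atom _) (σT {atom _} {atom _}) _))))
        (trans≈ (∘ʳ (∘ʳ (∘ʳ (sym≈ (commute unit (box₀ f) _)))))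
        (trans≈ (sym≈ (∘ʳ (slide-splitʳ (atom _) (box₀ g))))
        (sym≈ (commute (atom _) (σT {atom _} {atom _}) _)))))
    stages (suc n) (M , f , t) (N , g , u) (M' , h , v) (N' , k , w) =
      let (m , eq) = stages zero (M , f) (N , g) (M' , h) (N' , k)
      in  m , ι , ι-involutive , eq , stagesFrom 1 n t u v w

  -- Naturality of α: (f ⊗ᶜ (g ⊗ᶜ h)) ∘ᶜ α = α ∘ᶜ ((f ⊗ᶜ g) ⊗ᶜ h).  The
  -- memories ((M ⊗ N) ⊗ O) ⊗ 𝟙 and 𝟙 ⊗ (M ⊗ (N ⊗ O)) are identified by
  -- the evident structure isomorphism.
  module α-Naturality {X Y Z X' Y' Z' : Fam} where
    αs : FamHom ((X' ⊗ᶠ Y') ⊗ᶠ Z') (X' ⊗ᶠ (Y' ⊗ᶠ Z'))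
    αs _ = α
    αs' : FamHom ((X ⊗ᶠ Y) ⊗ᶠ Z) (X ⊗ᶠ (Y ⊗ᶠ Z))
    αs' _ = α
    memory-iso : ∀ {M N O} → ((unitorʳ⁻¹ ∘ (α⁻¹ ∘ unitorˡ)) ∘ (unitorˡ⁻¹ ∘ (α {M} {N} {O} ∘ unitorʳ))) ≈ id
    memory-iso {M} {N} {O} =
      coherence-chain ((ρ⁻¹T ∘T (α⁻¹T ∘T λT)) ∘T (λ⁻¹T ∘T (αT ∘T ρT))) (idT {((atom M ⊗w atom N) ⊗w atom O) ⊗w unit}) refl≈
    stagesFrom : ∀ j n {P Q R} (t : Tuple X X' P j n) (u : Tuple Y Y' Q j n) (v : Tuple Z Z' R j n) →
                 Conjugate j n (unitorʳ⁻¹ ∘ (α⁻¹ ∘ unitorˡ))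
                   (seqT j n id (parT j n id (parT j n id t u) v) (iT j n αs))
                   (seqT j n id (iT j n αs') (parT j n id t (parT j n id u v)))
    stagesFrom j zero (M , f) (N , g) (O , h) = (unitorˡ⁻¹ ∘ (α ∘ unitorʳ)) ,
      coherence-chain (seqTerm (unitConj αT) (parTerm (box f) (parTerm (box g) (box h) idT) idT) ∘T (idT ⊗T idT))
        (((λ⁻¹T ∘T (αT ∘T ρT)) ⊗T idT) ∘T ((seqTerm (parTerm (parTerm (box f) (box g) idT) (box h) idT) (unitConj αT) ∘T (idT ⊗T idT))
          ∘T ((ρ⁻¹T ∘T (α⁻¹T ∘T λT)) ⊗T idT)))
        (trans≈ (∘ʳ (∘ʳ (∘ʳ (∘ʳ (∘ʳ (∘ʳ (∘ʳ (∘ʳ (∘ʳ (swapChain-cancel unit (atom _ ⊗w (atom _ ⊗w atom _)) ((atom _ ⊗w atom _) ⊗w atom _) _))))))))))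
        (trans≈ (sym≈ (∘ʳ (∘ʳ (∘ʳ (∘ʳ (∘ʳ (∘ʳ (commute (atom _) (σT {atom _} {atom _}) _))))))))
        (trans≈ (sym≈ (∘ʳ (∘ʳ (∘ʳ (∘ʳ (∘ʳ (commute (atom _) (σT {atom _} {atom _}) _)))))))
        (trans≈ (sym≈ (∘ʳ (∘ʳ (sym≈ (commute unit (box f) _)))))
        (sym≈ (∘ʳ (sym≈ (commute (atom _) (σT {atom _} {atom _}) _))))))))
    stagesFrom j (suc n) (M , f , t) (N , g , u) (O , h , v) =
      let (m , eq) = stagesFrom j zero (M , f) (N , g) (O , h)
      in  m , (unitorʳ⁻¹ ∘ (α⁻¹ ∘ unitorˡ)) , memory-iso , eq , stagesFrom (suc j) n t u v
    stages : ∀ n (t : Rep X X' n) (u : Rep Y Y' n) (v : Rep Z Z' n) →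
             Conjugate 0 n id
               (seqT 0 n unitorˡ⁻¹ (parT 0 n unitorˡ⁻¹ (parT 0 n unitorˡ⁻¹ t u) v) (iT 0 n αs))
               (seqT 0 n unitorˡ⁻¹ (iT 0 n αs') (parT 0 n unitorˡ⁻¹ t (parT 0 n unitorˡ⁻¹ u v)))
    stages zero (M , f) (N , g) (O , h) = (unitorˡ⁻¹ ∘ (α ∘ unitorʳ)) ,
      coherence-chain (seqTerm (unitConj αT) (parTerm (box₀ f) (parTerm (box₀ g) (box₀ h) λ⁻¹T) λ⁻¹T) ∘T (λ⁻¹T ⊗T idT))
        (((λ⁻¹T ∘T (αT ∘T ρT)) ⊗T idT) ∘T ((seqTerm (parTerm (parTerm (box₀ f) (box₀ g) λ⁻¹T) (box₀ h) λ⁻¹T) (unitConj αT) ∘T (λ⁻¹T ⊗T idT))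
          ∘T (idT ⊗T idT)))
        (trans≈ (∘ʳ (∘ʳ (commute unit (box₀ f) _)))
        (sym≈ (∘ʳ (sym≈ (commute (atom _) (σT {atom _} {atom _}) _)))))
    stages (suc n) (M , f , t) (N , g , u) (O , h , v) =
      let (m , eq) = stages zero (M , f) (N , g) (O , h)
      in  m , (unitorʳ⁻¹ ∘ (α⁻¹ ∘ unitorˡ)) , memory-iso , eq , stagesFrom 1 n t u v

  -- Naturality of σ: (g ⊗ᶜ f) ∘ᶜ σ = σ ∘ᶜ (f ⊗ᶜ g), with memories
  -- (M ⊗ N) ⊗ 𝟙 and 𝟙 ⊗ (N ⊗ M) identified through σ.
  module σ-Naturality {X Y X' Y' : Fam} where
    σs : FamHom (X' ⊗ᶠ Y') (Y' ⊗ᶠ X')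
    σs _ = σ
    σs' : FamHom (X ⊗ᶠ Y) (Y ⊗ᶠ X)
    σs' _ = σ
    memory-iso : ∀ {M N} → ((unitorʳ⁻¹ ∘ (σ ∘ unitorˡ)) ∘ (unitorˡ⁻¹ ∘ (σ {M} {N} ∘ unitorʳ))) ≈ id
    memory-iso {M} {N} =
      coherence-chain ((ρ⁻¹T ∘T (σT ∘T λT)) ∘T (λ⁻¹T ∘T (σT ∘T ρT))) (idT {(atom M ⊗w atom N) ⊗w unit}) (cancel-sw unit)
    stagesFrom : ∀ j n {P Q} (t : Tuple X X' P j n) (u : Tuple Y Y' Q j n) →
                 Conjugate j n (unitorʳ⁻¹ ∘ (σ ∘ unitorˡ))
                   (seqT j n id (parT j n id t u) (iT j n σs))
                   (seqT j n id (iT j n σs') (parT j n id u t))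
    stagesFrom j zero (M , f) (N , g) = (unitorˡ⁻¹ ∘ (σ ∘ unitorʳ)) ,
      coherence-chain (seqTerm (unitConj σT) (parTerm (box g) (box f) idT) ∘T (idT ⊗T idT))
        (((λ⁻¹T ∘T (σT ∘T ρT)) ⊗T idT) ∘T ((seqTerm (parTerm (box f) (box g) idT) (unitConj σT) ∘T (idT ⊗T idT))
          ∘T ((ρ⁻¹T ∘T (σT ∘T λT)) ⊗T idT)))
        (trans≈ (∘ʳ (∘ʳ (∘ʳ (∘ʳ (swapChain-naturalʳ unit (atom _ ⊗w atom _) (σT {atom _} {atom _}) _)))))
        (trans≈ (∘ʳ (∘ʳ (∘ʳ (∘ʳ (∘ʳ (swapChain-cancel unit (atom _ ⊗w atom _) (atom _ ⊗w atom _) _))))))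
        (trans≈ (∘ʳ (∘ʳ (∘ʳ (∘ʳ (∘ʳ (sym≈ (cancel-sw unit)))))))
        (trans≈ (∘ʳ (∘ʳ (∘ʳ (∘ʳ (∘ʳ (∘ʳ (sym≈ (cancel-sw (atom _)))))))))
        (trans≈ (sym≈ (∘ʳ (∘ʳ (∘ʳ (∘ʳ (commute unit (σT {atom _} {atom _}) _))))))
        (trans≈ (sym≈ (∘ʳ (∘ʳ (swapChain-naturalʳ unit (atom _ ⊗w atom _) (box f) _))))
        (trans≈ (sym≈ (∘ʳ (swapChain-naturalˡ unit (atom _ ⊗w atom _) (box g) _)))
        (trans≈ (cancel-sw (atom _))
        (sym≈ (∘ʳ (∘ʳ (∘ʳ (commute unit (box f) _)))))))))))))
    stagesFrom j (suc n) (M , f , t) (N , g , u) =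
      let (m , eq) = stagesFrom j zero (M , f) (N , g)
      in  m , (unitorʳ⁻¹ ∘ (σ ∘ unitorˡ)) , memory-iso , eq , stagesFrom (suc j) n t u
    stages : ∀ n (t : Rep X X' n) (u : Rep Y Y' n) →
             Conjugate 0 n id (seqT 0 n unitorˡ⁻¹ (parT 0 n unitorˡ⁻¹ t u) (iT 0 n σs))
                              (seqT 0 n unitorˡ⁻¹ (iT 0 n σs') (parT 0 n unitorˡ⁻¹ u t))
    stages zero (M , f) (N , g) = (unitorˡ⁻¹ ∘ (σ ∘ unitorʳ)) ,
      coherence-chain (seqTerm (unitConj σT) (parTerm (box₀ g) (box₀ f) λ⁻¹T) ∘T (λ⁻¹T ⊗T idT))
        (((λ⁻¹T ∘T (σT ∘T ρT)) ⊗T idT) ∘T ((seqTerm (parTerm (box₀ f) (box₀ g) λ⁻¹T) (unitConj σT) ∘T (λ⁻¹T ⊗T idT)) ∘T (idT ⊗T idT)))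
        (trans≈ (∘ʳ (∘ʳ (sym≈ (slide-splitʳ unit (box₀ f)))))
        (trans≈ (∘ʳ (sym≈ (slide-splitˡ unit (box₀ g))))
        (trans≈ (cancel-sw (atom _))
        (trans≈ (sym≈ (∘ʳ (slide-splitˡ (atom _) (box₀ g))))
        (sym≈ (∘ʳ (∘ʳ (∘ʳ (commute unit (box₀ f) _)))))))))
    stages (suc n) (M , f , t) (N , g , u) =
      let (m , eq) = stages zero (M , f) (N , g)
      in  m , (unitorʳ⁻¹ ∘ (σ ∘ unitorˡ)) , memory-iso , eq , stagesFrom 1 n t u

  id𝟙 : FamHom 𝟙ᶠ 𝟙ᶠ
  id𝟙 _ = id

  -- Naturality of λ: f ∘ᶜ λ = λ ∘ᶜ (id ⊗ᶜ f), with memories identified by ρ.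
  module unitorˡ-Naturality {X Y : Fam} where
    λs : (W : Fam) → FamHom (𝟙ᶠ ⊗ᶠ W) W
    λs W _ = unitorˡ
    stagesFrom : ∀ j n {P} (t : Tuple X Y P j n) →
                 Conjugate j n unitorʳ⁻¹ (seqT j n id (parT j n id (iT j n id𝟙) t) (iT j n (λs Y))) (seqT j n id (iT j n (λs X)) t)
    stagesFrom j zero (M , f) = unitorʳ ,
      coherence-chain (seqTerm (unitConj λT) (box f) ∘T (idT ⊗T idT))
        ((ρT ⊗T idT) ∘T ((seqTerm (parTerm (unitConj idT) (box f) idT) (unitConj λT) ∘T (idT ⊗T idT)) ∘T (ρ⁻¹T ⊗T idT)))
        (∘ʳ (cancel-sw unit))
    stagesFrom j (suc n) (M , f , t) =
      let (m , eq) = stagesFrom j zero (M , f)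
      in  m , unitorʳ⁻¹ , unitorʳ-isoˡ , eq , stagesFrom (suc j) n t
    stages : ∀ n (t : Rep X Y n) →
             Conjugate 0 n id (seqT 0 n unitorˡ⁻¹ (parT 0 n unitorˡ⁻¹ (iT 0 n id𝟙) t) (iT 0 n (λs Y))) (seqT 0 n unitorˡ⁻¹ (iT 0 n (λs X)) t)
    stages zero (M , f) = unitorʳ ,
      coherence-chain (seqTerm (unitConj λT) (box₀ f) ∘T (λ⁻¹T ⊗T idT))
        ((ρT ⊗T idT) ∘T ((seqTerm (parTerm (unitConj idT) (box₀ f) λ⁻¹T) (unitConj λT) ∘T (λ⁻¹T ⊗T idT)) ∘T (idT ⊗T idT)))
        refl≈
    stages (suc n) (M , f , t) =
      let (m , eq) = stages zero (M , f)
      in  m , unitorʳ⁻¹ , unitorʳ-isoˡ , eq , stagesFrom 1 n t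

  module unitorʳ-Naturality {X Y : Fam} where
    ρs : (W : Fam) → FamHom (W ⊗ᶠ 𝟙ᶠ) W
    ρs W _ = unitorʳ
    memory-iso : ∀ {M} → ((unitorʳ⁻¹ ∘ (unitorʳ⁻¹ ∘ unitorˡ)) ∘ (unitorˡ⁻¹ ∘ (unitorʳ ∘ unitorʳ {M ⊗₀ 𝟙}))) ≈ id
    memory-iso {M} = coherence-chain ((ρ⁻¹T ∘T (ρ⁻¹T ∘T λT)) ∘T (λ⁻¹T ∘T (ρT ∘T ρT))) (idT {(atom M ⊗w unit) ⊗w unit}) refl≈
    stagesFrom : ∀ j n {P} (t : Tuple X Y P j n) →
                 Conjugate j n (unitorʳ⁻¹ ∘ (unitorʳ⁻¹ ∘ unitorˡ)) (seqT j n id (parT j n id t (iT j n id𝟙)) (iT j n (ρs Y)))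
                   (seqT j n id (iT j n (ρs X)) t)
    stagesFrom j zero (M , f) = (unitorˡ⁻¹ ∘ (unitorʳ ∘ unitorʳ)) ,
      coherence-chain (seqTerm (unitConj ρT) (box f) ∘T (idT ⊗T idT))
        (((λ⁻¹T ∘T (ρT ∘T ρT)) ⊗T idT) ∘T ((seqTerm (parTerm (box f) (unitConj idT) idT) (unitConj ρT) ∘T (idT ⊗T idT))
          ∘T ((ρ⁻¹T ∘T (ρ⁻¹T ∘T λT)) ⊗T idT)))
        (∘ʳ (cancel-sw unit))
    stagesFrom j (suc n) (M , f , t) =
      let (m , eq) = stagesFrom j zero (M , f)
      in  m , (unitorʳ⁻¹ ∘ (unitorʳ⁻¹ ∘ unitorˡ)) , memory-iso , eq , stagesFrom (suc j) n t
    stages : ∀ n (t : Rep X Y n) →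
             Conjugate 0 n id (seqT 0 n unitorˡ⁻¹ (parT 0 n unitorˡ⁻¹ t (iT 0 n id𝟙)) (iT 0 n (ρs Y))) (seqT 0 n unitorˡ⁻¹ (iT 0 n (ρs X)) t)
    stages zero (M , f) = (unitorˡ⁻¹ ∘ (unitorʳ ∘ unitorʳ)) ,
      coherence-chain (seqTerm (unitConj ρT) (box₀ f) ∘T (λ⁻¹T ⊗T idT))
        (((λ⁻¹T ∘T (ρT ∘T ρT)) ⊗T idT) ∘T ((seqTerm (parTerm (box₀ f) (unitConj idT) λ⁻¹T) (unitConj ρT) ∘T (λ⁻¹T ⊗T idT))
          ∘T (idT ⊗T idT)))
        refl≈
    stages (suc n) (M , f , t) =
      let (m , eq) = stages zero (M , f)
      in  m , (unitorʳ⁻¹ ∘ (unitorʳ⁻¹ ∘ unitorˡ)) , memory-iso , eq , stagesFrom 1 n t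

  module i-Congruence {X Y : Fam} (h h' : FamHom X Y) (p : ∀ n → h n ≈ h' n) where
    stagesFrom : ∀ j n → Conjugate j n id (iT j n h) (iT j n h')
    stagesFrom j zero = id ,
      sym≈ (trans≈ (∘ˡ ⊗-identity) (trans≈ identityˡ (trans≈ (∘ʳ ⊗-identity) (trans≈ identityʳ (∘ʳ (∘ˡ (p j)))))))
    stagesFrom j (suc n) =
      let (m , eq) = stagesFrom j zero
      in  m , id , identityˡ , eq , stagesFrom (suc j) n

  -- i preserves composition; the memories 𝟙 ⊗ 𝟙 are identified with 𝟙.
  module i-Composition {X Y Z : Fam} (h : FamHom Y Z) (k : FamHom X Y) where
    hk : FamHom X Z
    hk n = h n ∘ k n
    stagesFrom : ∀ j n → Conjugate j n unitorˡ (iT j n hk) (seqT j n id (iT j n k) (iT j n h))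
    stagesFrom j zero = unitorˡ⁻¹ ,
      coherence-chain (seqTerm (unitConj (arr (k j))) (unitConj (arr (h j))) ∘T (idT ⊗T idT))
        ((λ⁻¹T ⊗T idT) ∘T (unitConj (arr (h j) ∘T arr (k j)) ∘T (λT ⊗T idT))) refl≈
    stagesFrom j (suc n) =
      let (m , eq) = stagesFrom j zero
      in  m , unitorˡ , unitorˡ-isoʳ , eq , stagesFrom (suc j) n
    stages : ∀ n → Conjugate 0 n id (iT 0 n hk) (seqT 0 n unitorˡ⁻¹ (iT 0 n k) (iT 0 n h))
    stages zero = unitorˡ⁻¹ ,
      coherence-chain (seqTerm (unitConj (arr (k 0))) (unitConj (arr (h 0))) ∘T (λ⁻¹T ⊗T idT))
        ((λ⁻¹T ⊗T idT) ∘T (unitConj (arr (h 0) ∘T arr (k 0)) ∘T (idT ⊗T idT))) refl≈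
    stages (suc n) =
      let (m , eq) = stages zero
      in  m , unitorˡ , unitorˡ-isoʳ , eq , stagesFrom 1 n

  module i-Tensor {X Y X' Y' : Fam} (h : FamHom X Y) (h' : FamHom X' Y') where
    hh : FamHom (X ⊗ᶠ X') (Y ⊗ᶠ Y')
    hh n = h n ⊗₁ h' n
    stagesFrom : ∀ j n → Conjugate j n unitorˡ (iT j n hh) (parT j n id (iT j n h) (iT j n h'))
    stagesFrom j zero = unitorˡ⁻¹ ,
      coherence-chain (parTerm (unitConj (arr (h j))) (unitConj (arr (h' j))) idT)
        ((λ⁻¹T ⊗T idT) ∘T (unitConj (arr (h j) ⊗T arr (h' j)) ∘T (λT ⊗T idT))) refl≈
    stagesFrom j (suc n) =
      let (m , eq) = stagesFrom j zero
      in  m , unitorˡ , unitorˡ-isoʳ , eq , stagesFrom (suc j) n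
    stages : ∀ n → Conjugate 0 n id (iT 0 n hh) (parT 0 n unitorˡ⁻¹ (iT 0 n h) (iT 0 n h'))
    stages zero = unitorˡ⁻¹ ,
      coherence-chain (parTerm (unitConj (arr (h 0))) (unitConj (arr (h' 0))) λ⁻¹T)
        ((λ⁻¹T ⊗T idT) ∘T (unitConj (arr (h 0) ⊗T arr (h' 0)) ∘T (idT ⊗T idT))) refl≈
    stages (suc n) =
      let (m , eq) = stages zero
      in  m , unitorˡ , unitorˡ-isoʳ , eq , stagesFrom 1 n

module Comb∞SMC {o ℓ e} (𝒞 : SMC o ℓ e) where
  open SMCReasoning 𝒞
  open Combs 𝒞
  open CombCalculus 𝒞
  open CombLaws 𝒞

  -- Equality of combs wrapped in a record, so that implicit arguments can be
  -- inferred from it (≈∞ itself is a function type).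
  infix 4 _≃_
  record _≃_ {X Y : Fam} (f g : Comb∞ X Y) : Set (o ⊔ ℓ ⊔ e) where
    constructor mk
    field unw : f ≈∞ g
  open _≃_

  ≃-refl : ∀ {X Y} {f : Comb∞ X Y} → f ≃ f
  ≃-refl = mk (λ n → ε)
  ≃-sym : ∀ {X Y} {f g : Comb∞ X Y} → f ≃ g → g ≃ f
  ≃-sym (mk p) = mk (λ n → CombEq-Equiv.sym (p n))
  ≃-trans : ∀ {X Y} {f g h : Comb∞ X Y} → f ≃ g → g ≃ h → f ≃ h
  ≃-trans (mk p) (mk q) = mk (λ n → CombEq-Equiv.trans (p n) (q n))

  ∘ᶜ-resp : ∀ {X Y Z} {f f' : Comb∞ Y Z} {g g' : Comb∞ X Y} → f ≃ f' → g ≃ g' → (f ∘ᶜ g) ≃ (f' ∘ᶜ g')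
  ∘ᶜ-resp {f = f} {f'} {g} {g'} (mk p) (mk q) = mk (λ n → CombEq-Equiv.trans (seq-congʳ n (stage g n) (p n)) (seq-congˡ n (stage f' n) (q n)))
  ⊗ᶜ-resp : ∀ {X Y X' Y'} {f f' : Comb∞ X Y} {g g' : Comb∞ X' Y'} → f ≃ f' → g ≃ g' → (f ⊗ᶜ g) ≃ (f' ⊗ᶜ g')
  ⊗ᶜ-resp {f = f} {f'} {g} {g'} (mk p) (mk q) = mk (λ n → CombEq-Equiv.trans (par-congˡ n (stage g n) (p n)) (par-congʳ n (stage f' n) (q n)))

  i-resp : ∀ {X Y} {h h' : FamHom X Y} → (∀ n → h n ≈ h' n) → i h ≃ i h'
  i-resp {h = h} {h'} p = mk (λ n → conjugate⇒CombEq n _ _ (i-Congruence.stagesFrom h h' p 0 n))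
  i-comp : ∀ {X Y Z} (h : FamHom Y Z) (k : FamHom X Y) → i (λ n → h n ∘ k n) ≃ (i h ∘ᶜ i k)
  i-comp h k = mk (λ n → conjugate⇒CombEq n _ _ (i-Composition.stages h k n))
  i-tensor : ∀ {X Y X' Y'} (h : FamHom X Y) (h' : FamHom X' Y') → i (λ n → h n ⊗₁ h' n) ≃ (i h ⊗ᶜ i h')
  i-tensor h h' = mk (λ n → conjugate⇒CombEq n _ _ (i-Tensor.stages h h' n))

  i-iso : ∀ {X Y} (h : FamHom Y X) (k : FamHom X Y) → (∀ n → (h n ∘ k n) ≈ id) → (i h ∘ᶜ i k) ≈∞ i (λ n → id)
  i-iso h k p = unw (≃-trans (≃-sym (i-comp h k)) (i-resp p))

  -- The laws that only involve images of i
  -- (isomorphism laws, pentagon, triangle, hexagon) are transported from C.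
  comb∞ : CombStructure
  comb∞ = record
    { id = i (λ n → id)
    ; _∘_ = _∘ᶜ_
    ; _⊗₁_ = _⊗ᶜ_
    ; α = i (λ n → α)
    ; α⁻¹ = i (λ n → α⁻¹)
    ; unitorˡ = i (λ n → unitorˡ)
    ; unitorˡ⁻¹ = i (λ n → unitorˡ⁻¹)
    ; unitorʳ = i (λ n → unitorʳ)
    ; unitorʳ⁻¹ = i (λ n → unitorʳ⁻¹)
    ; σ = i (λ n → σ)
    ; ≈-equiv = record { refl = λ n → ε ; sym = λ p n → CombEq-Equiv.sym (p n) ; trans = λ p q n → CombEq-Equiv.trans (p n) (q n) }
    ; ∘-resp-≈ = λ {_} {_} {_} {f} {f'} {g} {g'} p q → unw (∘ᶜ-resp {f = f} {f'} {g} {g'} (mk p) (mk q))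
    ; identityˡ = λ {_} {_} {f} n → conjugate⇒CombEq n _ _ (LeftIdentity.stages n (stage f n))
    ; identityʳ = λ {_} {_} {f} n → conjugate⇒CombEq n _ _ (RightIdentity.stages n (stage f n))
    ; assoc = λ {_} {_} {_} {_} {f} {g} {h} n → conjugate⇒CombEq n _ _ (Associativity.stages n (stage f n) (stage g n) (stage h n))
    ; ⊗-resp-≈ = λ {_} {_} {_} {_} {f} {f'} {g} {g'} p q → unw (⊗ᶜ-resp {f = f} {f'} {g} {g'} (mk p) (mk q))
    ; ⊗-identity = unw (≃-trans (≃-sym (i-tensor (λ n → id) (λ n → id))) (i-resp (λ n → ⊗-identity)))
    ; ⊗-homomorphism = λ {_} {_} {_} {_} {_} {_} {f} {g} {h} {k} n →
        conjugate⇒CombEq n _ _ (Interchange.stages n (stage f n) (stage g n) (stage h n) (stage k n))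
    ; α-natural = λ {_} {_} {_} {_} {_} {_} {f} {g} {h} n → conjugate⇒CombEq n _ _ (α-Naturality.stages n (stage f n) (stage g n) (stage h n))
    ; α-isoˡ = i-iso (λ n → α⁻¹) (λ n → α) (λ n → α-isoˡ)
    ; α-isoʳ = i-iso (λ n → α) (λ n → α⁻¹) (λ n → α-isoʳ)
    ; unitorˡ-natural = λ {_} {_} {f} n → conjugate⇒CombEq n _ _ (unitorˡ-Naturality.stages n (stage f n))
    ; unitorˡ-isoˡ = i-iso (λ n → unitorˡ⁻¹) (λ n → unitorˡ) (λ n → unitorˡ-isoˡ)
    ; unitorˡ-isoʳ = i-iso (λ n → unitorˡ) (λ n → unitorˡ⁻¹) (λ n → unitorˡ-isoʳ)
    ; unitorʳ-natural = λ {_} {_} {f} n → conjugate⇒CombEq n _ _ (unitorʳ-Naturality.stages n (stage f n))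
    ; unitorʳ-isoˡ = i-iso (λ n → unitorʳ⁻¹) (λ n → unitorʳ) (λ n → unitorʳ-isoˡ)
    ; unitorʳ-isoʳ = i-iso (λ n → unitorʳ) (λ n → unitorʳ⁻¹) (λ n → unitorʳ-isoʳ)
    ; σ-natural = λ {_} {_} {_} {_} {f} {g} n → conjugate⇒CombEq n _ _ (σ-Naturality.stages n (stage f n) (stage g n))
    ; σ-involutive = i-iso (λ n → σ) (λ n → σ) (λ n → σ-involutive)
    ; pentagon = unw pent
    ; triangle = unw tri
    ; hexagon = unw hex
    }
    where
    pent : ∀ {W X Y Z : Fam} →
      (i (λ n → α {W n} {X n} {Y n ⊗₀ Z n}) ∘ᶜ i (λ n → α {W n ⊗₀ X n} {Y n} {Z n})) ≃
      ((i (λ n → id {W n}) ⊗ᶜ i (λ n → α {X n} {Y n} {Z n})) ∘ᶜ (i (λ n → α {W n} {X n ⊗₀ Y n} {Z n}) ∘ᶜ (i (λ n → α {W n} {X n} {Y n}) ⊗ᶜ i (λ n → id {Z n}))))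
    pent = ≃-trans (≃-sym (i-comp _ _)) (≃-trans (i-resp (λ n → pentagon))
             (≃-trans (i-comp _ _) (∘ᶜ-resp (i-tensor _ _) (≃-trans (i-comp _ _) (∘ᶜ-resp ≃-refl (i-tensor _ _))))))
    tri : ∀ {X Y : Fam} →
      ((i (λ n → id {X n}) ⊗ᶜ i (λ n → unitorˡ {Y n})) ∘ᶜ i (λ n → α {X n} {𝟙} {Y n})) ≃
      (i (λ n → unitorʳ {X n}) ⊗ᶜ i (λ n → id {Y n}))
    tri = ≃-trans (∘ᶜ-resp (≃-sym (i-tensor _ _)) ≃-refl) (≃-trans (≃-sym (i-comp _ _))
            (≃-trans (i-resp (λ n → triangle)) (i-tensor _ _)))
    hex : ∀ {X Y Z : Fam} →
      (i (λ n → α {Y n} {Z n} {X n}) ∘ᶜ (i (λ n → σ {X n} {Y n ⊗₀ Z n}) ∘ᶜ i (λ n → α {X n} {Y n} {Z n}))) ≃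
      ((i (λ n → id {Y n}) ⊗ᶜ i (λ n → σ {X n} {Z n})) ∘ᶜ (i (λ n → α {Y n} {X n} {Z n}) ∘ᶜ (i (λ n → σ {X n} {Y n}) ⊗ᶜ i (λ n → id {Z n}))))
    hex = ≃-trans (∘ᶜ-resp ≃-refl (≃-sym (i-comp _ _))) (≃-trans (≃-sym (i-comp _ _))
            (≃-trans (i-resp (λ n → hexagon))
              (≃-trans (i-comp _ _) (∘ᶜ-resp (i-tensor _ _) (≃-trans (i-comp _ _) (∘ᶜ-resp ≃-refl (i-tensor _ _)))))))

  -- comb∞ is the structure described in the theorem: all its data agree
  -- with the prescribed ones on the nose (ε is the reflexive step).
  comb∞-spec : IsComb∞SMC comb∞
  comb∞-spec = record
    { comp-is-seq = λ g f n → ε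
    ; tensor-is-par = λ f f' n → ε
    ; id-is-i = λ n → ε
    ; α-is-i = λ n → ε
    ; α⁻¹-is-i = λ n → ε
    ; unitorˡ-is-i = λ n → ε
    ; unitorˡ⁻¹-is-i = λ n → ε
    ; unitorʳ-is-i = λ n → ε
    ; unitorʳ⁻¹-is-i = λ n → ε
    ; σ-is-i = λ n → ε
    ; i-resp-≈ = λ p → unw (i-resp p)
    ; i-∘ = λ h k → unw (i-comp h k)
    ; i-⊗ = λ h h' → unw (i-tensor h h')
    }

mainTheorem1 : ∀ {o ℓ e} (C : SMC o ℓ e) →
    Σ (Combs.CombStructure C) (Combs.IsComb∞SMC C)
mainTheorem1 C = Comb∞SMC.comb∞ C , Comb∞SMC.comb∞-spec C
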